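{- For any $w\in\mathfrak{H}^1$, we have $[\delta,\varphi](w)=W(w)$.
   Context: $\mathfrak{H}^1=\mathbb{Q}\langle z_k\mid k\ge1\rangle\cong\mathbb{Q}+\mathbb{Q}\langle x,y\rangle y$ via $z_k=x^{k-1}y$, with harmonic product $\ast$ and shuffle product $\sqcup\!\sqcup$. $\varphi(w)=w\ast z_2-w\sqcup\!\sqcup z_2$; $W$ multiplies a word $z_{k_1}\cdots z_{k_r}$ by $k_1+\cdots+k_r$; $\delta(w)=\big(\tfrac12\mathbf{1}_{w=(yx)u}-\tfrac12\mathbf{1}_{w=(xy)u}+\tfrac14\mathbf{1}_{w=(yy)u}\big)u+\tfrac12\big(\sum_{w=u(yyx)u'}-\sum_{w=u(xyy)u'}\big)uyu'$ (the restriction to $\mathfrak{H}^1$ of the $\tau$-equivariant derivation $\delta$ of Bachmann–Ihara–Matthes). -}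

module Defs where

open import Data.Nat as ℕ using (ℕ; zero; suc)
open import Data.Integer using (+_)
open import Data.Rational using (ℚ; 0ℚ; 1ℚ; _/_; -_) renaming (_+_ to _+ℚ_; _*_ to _*ℚ_)
open import Data.List using (List; []; _∷_; _++_; map; replicate; foldr; concatMap)
open import Data.List.Properties using (≡-dec)
open import Data.Product using (_×_; _,_)
open import Relation.Binary.PropositionalEquality using (_≡_)
open import Relation.Nullary using (yes; no)

data Letter : Set where
  x y : Letter

XYWord : Set
XYWord = List Letter

-- A word z_{k₁} ⋯ z_{k_r} of 𝔥¹ is encoded as the list [k₁ - 1, …, k_r - 1]
-- (entry n stands for the letter z_{n+1}, so that every k_i ≥ 1).
ZWord : Set
ZWord = List ℕ

Lin : Set → Set
Lin A = List (ℚ × A)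

H1 : Set
H1 = Lin ZWord

coeff : Lin ZWord → ZWord → ℚ
coeff [] u = 0ℚ
coeff ((c , v) ∷ p) u with ≡-dec ℕ._≟_ v u
... | yes _ = c +ℚ coeff p u
... | no _  = coeff p u

infix 4 _≈_
_≈_ : H1 → H1 → Set
p ≈ q = ∀ u → coeff p u ≡ coeff q u

scale : {A : Set} → ℚ → Lin A → Lin A
scale c = map (λ { (d , u) → (c *ℚ d , u) })

infixl 6 _⊕_ _⊖_
_⊕_ : {A : Set} → Lin A → Lin A → Lin A
p ⊕ q = p ++ q

_⊖_ : {A : Set} → Lin A → Lin A → Lin A
p ⊖ q = p ++ scale (- 1ℚ) q

word : {A : Set} → A → Lin A
word u = (1ℚ , u) ∷ []

linExt : {A B : Set} → (A → Lin B) → Lin A → Lin B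
linExt f = concatMap (λ { (c , u) → scale c (f u) })

bilinExt : {A B C : Set} → (A → B → Lin C) → Lin A → Lin B → Lin C
bilinExt f p q = linExt (λ u → linExt (λ v → f u v) q) p

prefix : {A : Set} → A → Lin (List A) → Lin (List A)
prefix a = map (λ { (c , u) → (c , a ∷ u) })

-- identification z_k = x^{k-1} y
fromZ : ZWord → XYWord
fromZ [] = []
fromZ (n ∷ u) = replicate n x ++ (y ∷ fromZ u)

-- inverse on ℚ + ℚ⟨x,y⟩y (only ever applied to such words)
toZ′ : ℕ → XYWord → ZWord
toZ′ n [] = []
toZ′ n (x ∷ w) = toZ′ (suc n) w
toZ′ n (y ∷ w) = n ∷ toZ′ 0 w

toZ : XYWord → ZWord
toZ = toZ′ 0

toZLin : Lin XYWord → Lin ZWord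
toZLin = map (λ { (c , w) → (c , toZ w) })

harmW : ZWord → ZWord → Lin ZWord
harmW [] v = word v
harmW (a ∷ u) [] = word (a ∷ u)
harmW (a ∷ u) (b ∷ v) =
  prefix a (harmW u (b ∷ v)) ⊕ prefix b (harmW (a ∷ u) v)
    ⊕ prefix (suc (a ℕ.+ b)) (harmW u v)

shW : XYWord → XYWord → Lin XYWord
shW [] v = word v
shW (a ∷ u) [] = word (a ∷ u)
shW (a ∷ u) (b ∷ v) = prefix a (shW u (b ∷ v)) ⊕ prefix b (shW (a ∷ u) v)

infixl 7 _∗_ _ш_
_∗_ : H1 → H1 → H1
_∗_ = bilinExt harmW

_ш_ : H1 → H1 → H1
_ш_ = bilinExt (λ u v → toZLin (shW (fromZ u) (fromZ v)))

z₂ : H1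
z₂ = word (1 ∷ [])

φ : H1 → H1
φ w = w ∗ z₂ ⊖ w ш z₂

weight : ZWord → ℕ
weight = foldr (λ n s → suc n ℕ.+ s) 0

W : H1 → H1
W = linExt (λ u → (+ weight u / 1 , u) ∷ [])

half quarter : ℚ
half = + 1 / 2
quarter = + 1 / 4

δhead : XYWord → Lin XYWord
δhead (y ∷ x ∷ u) = (half , u) ∷ []
δhead (x ∷ y ∷ u) = (- half , u) ∷ []
δhead (y ∷ y ∷ u) = (quarter , u) ∷ []
δhead _ = []

δmid : XYWord → Lin XYWord
δmid [] = []
δmid (a ∷ w) = local (a ∷ w) ⊕ prefix a (δmid w)
  where
  local : XYWord → Lin XYWord
  local (y ∷ y ∷ x ∷ u′) = (half , y ∷ u′) ∷ []
  local (x ∷ y ∷ y ∷ u′) = (- half , y ∷ u′) ∷ []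
  local _ = []

δW : XYWord → Lin XYWord
δW w = δhead w ⊕ δmid w

-- δ restricted to 𝔥¹ (it maps ℚ + ℚ⟨x,y⟩y into itself)
δ : H1 → H1
δ = linExt (λ u → toZLin (δW (fromZ u)))

commδφ : H1 → H1
commδφ w = δ (φ w) ⊖ φ (δ w)

{-# OPTIONS --safe #-}

-- A z-word z_{k₁}⋯z_{k_r} is the xy-word x^{k₁-1}y⋯x^{k_r-1}y, whose length is its weight, and on
-- such words φ acts as Φ(w) = w ∗ z₂ − w ш xy.  With Ш(w) = w ш y the three operators obey prefix rules
--   Ш(a w) = a Ш(w) + y a w,   Φ(a w) = a Φ(w) + σ_a xxyw − x a Ш(w),   δ(a w) = a δ(w) + R_a(w),
-- where σ_x = −1, σ_y = 1 and R_a(w) only depends on the first two letters of w.  Hence, with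
-- κ_x = −1 and κ_y = 1/2,
--   [δ,Ш](abcu) − κ_a bcu = a ([δ,Ш](bcu) − κ_b cu),
--   [δ,Φ](abcu) = abcu + a [δ,Φ](bcu) − x a ([δ,Ш](bcu) − κ_b cu)
-- for all letters a, b, c and every word u; these identities, with u kept symbolic, are checked by a
-- verified normaliser that pushes the operators through prefixes.  Starting from the words of length
-- at most 2 in ℚ + ℚ⟨x,y⟩y, induction on the length gives [δ,Ш](a w) = κ_a w and then
-- [δ,Φ](w) = |w| w, i.e. [δ,φ] and W agree on z-words; both are linear.
module Submission where

open import Defs
open import Data.Bool using (Bool; true; false; _∧_; T)
open import Data.Bool.Properties using (T-∧)
open import Data.Empty using (⊥; ⊥-elim)
open import Data.Integer as ℤ using ()
open import Data.Integer.Properties as ℤ using ()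
open import Data.List using (List; []; _∷_; _++_; map; length; replicate)
open import Data.List.Instances
open import Data.List.Properties
  using (map-∘; map-++; map-id; ++-identityʳ; ++-assoc; concatMap-++; length-++; length-replicate)
open import Data.List.Relation.Unary.All as All using (All; []; _∷_)
open import Data.List.Relation.Unary.All.Properties using (++⁺; map⁺)
open import Data.Maybe using (Maybe; just; nothing)
open import Data.Nat as ℕ using (ℕ; zero; suc; _≤_; z≤n; s≤s)
open import Data.Nat.Coprimality using (1-coprimeTo) renaming (sym to coprime-sym)
open import Data.Nat.Instances
open import Data.Nat.Properties as ℕ using ()
open import Data.Product using (_×_; _,_; proj₁; proj₂; map₂)
open import Data.Rational using (ℚ; 0ℚ; 1ℚ; -_; _+_; _*_; _/_; mkℚ)
open import Data.Rational.Properties as ℚ using ()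
open import Data.Rational.Solver using (module +-*-Solver)
open import Data.Unit using (⊤; tt)
open import Function using (_∘_)
open import Function.Bundles using (Equivalence)
open import Relation.Binary.Bundles using (Setoid)
open import Relation.Binary.Definitions using (DecidableEquality)
open import Relation.Binary.PropositionalEquality
open import Relation.Binary.PropositionalEquality.Properties using (isDecEquivalence)
import Relation.Binary.Reasoning.Setoid
open import Relation.Binary.Structures using (IsEquivalence; IsDecEquivalence)
open import Relation.Binary.TypeClasses using (_≟_)
open import Relation.Nullary using (Dec; yes; no)

open +-*-Solver using (solve; _:+_; _:*_; con; _:=_)

*-+-collect : ∀ c d k s → c * k + (d * k + s) ≡ (c + d) * k + s
*-+-collect = solve 4 (λ c d k s → c :* k :+ (d :* k :+ s) := (c :+ d) :* k :+ s) refl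

+-exchange : ∀ a b s → a + (b + s) ≡ b + (a + s)
+-exchange = solve 3 (λ a b s → a :+ (b :+ s) := b :+ (a :+ s)) refl

0*k+0≡0 : ∀ k → 0ℚ * k + 0ℚ ≡ 0ℚ
0*k+0≡0 = solve 1 (λ k → con 0ℚ :* k :+ con 0ℚ := con 0ℚ) refl

a-a≡0 : ∀ a → a + (- 1ℚ) * a ≡ 0ℚ
a-a≡0 = solve 1 (λ a → a :+ con (- 1ℚ) :* a := con 0ℚ) refl

a-b≡0⇒a≡b : ∀ {a b} → a + (- 1ℚ) * b ≡ 0ℚ → a ≡ b
a-b≡0⇒a≡b {a} {b} a-b≡0 = begin
  a                        ≡⟨ solve 2 (λ a b → a := (a :+ con (- 1ℚ) :* b) :+ b) refl a b ⟩
  (a + (- 1ℚ) * b) + b     ≡⟨ cong (_+ b) a-b≡0 ⟩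
  0ℚ + b                   ≡⟨ ℚ.+-identityˡ b ⟩
  b                        ∎
  where open ≡-Reasoning

-- Formal linear combinations

private
  variable
    A B C : Set

DecEq : Set → Set
DecEq A = IsDecEquivalence {A = A} _≡_

-- prefix a and toZLin are definitionally relabel (a ∷_) and relabel toZ.
relabel : (A → B) → Lin A → Lin B
relabel g = map (map₂ g)

relabel-++ : (g : A → B) (p q : Lin A) → relabel g (p ++ q) ≡ relabel g p ++ relabel g q
relabel-++ g = map-++ (map₂ g)

relabel-∘ : (g : B → C) (h : A → B) (p : Lin A) → relabel g (relabel h p) ≡ relabel (g ∘ h) p
relabel-∘ g h p = sym (map-∘ p)

relabel-scale : (g : A → B) (c : ℚ) (p : Lin A) → relabel g (scale c p) ≡ scale c (relabel g p)
relabel-scale g c p = trans (sym (map-∘ p)) (map-∘ p)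

linExt-++ : (f : A → Lin B) (p q : Lin A) → linExt f (p ++ q) ≡ linExt f p ++ linExt f q
linExt-++ f p q = concatMap-++ _ p q

linExt-const-[] : (p : Lin A) → linExt {B = B} (λ _ → []) p ≡ []
linExt-const-[] [] = refl
linExt-const-[] (_ ∷ p) = linExt-const-[] p

linExt-relabel : (f : B → Lin C) (g : A → B) (p : Lin A) → linExt f (relabel g p) ≡ linExt (f ∘ g) p
linExt-relabel f g [] = refl
linExt-relabel f g ((c , u) ∷ p) = cong (scale c (f (g u)) ++_) (linExt-relabel f g p)

relabel-linExt : (g : B → C) (f : A → Lin B) (p : Lin A) → relabel g (linExt f p) ≡ linExt (relabel g ∘ f) p
relabel-linExt g f [] = refl
relabel-linExt g f ((c , u) ∷ p) = trans (relabel-++ g (scale c (f u)) (linExt f p))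
  (cong₂ _++_ (relabel-scale g c (f u)) (relabel-linExt g f p))

relabel-⊖ : (g : A → B) (p q : Lin A) → relabel g (p ⊖ q) ≡ relabel g p ⊖ relabel g q
relabel-⊖ g p q = trans (relabel-++ g p _) (cong (relabel g p ++_) (relabel-scale g (- 1ℚ) q))

module _ {A : Set} {{_ : DecEq A}} where

  coefficient : Lin A → A → ℚ
  coefficient [] u = 0ℚ
  coefficient ((c , v) ∷ p) u with v ≟ u
  ... | yes _ = c + coefficient p u
  ... | no _  = coefficient p u

  infix 4 _≋_
  record _≋_ (p q : Lin A) : Set where
    constructor mk≋
    field at : ∀ u → coefficient p u ≡ coefficient q u
  open _≋_ public

  ≋-isEquivalence : IsEquivalence _≋_
  ≋-isEquivalence = record
    { refl  = mk≋ λ u → refl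
    ; sym   = λ h → mk≋ λ u → sym (at h u)
    ; trans = λ h k → mk≋ λ u → trans (at h u) (at k u)
    }

  ≋-setoid : Setoid _ _
  ≋-setoid = record { isEquivalence = ≋-isEquivalence }

  open IsEquivalence ≋-isEquivalence public
    using () renaming (refl to ≋-refl; sym to ≋-sym; trans to ≋-trans; reflexive to ≡⇒≋)

  module ≋-Reasoning = Relation.Binary.Reasoning.Setoid ≋-setoid

  coefficient-++ : ∀ p q u → coefficient (p ++ q) u ≡ coefficient p u + coefficient q u
  coefficient-++ [] q u = sym (ℚ.+-identityˡ _)
  coefficient-++ ((c , v) ∷ p) q u with v ≟ u
  ... | yes _ = trans (cong (c +_) (coefficient-++ p q u)) (sym (ℚ.+-assoc c _ _))
  ... | no _  = coefficient-++ p q u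

  coefficient-scale : ∀ c p u → coefficient (scale c p) u ≡ c * coefficient p u
  coefficient-scale c [] u = sym (ℚ.*-zeroʳ c)
  coefficient-scale c ((d , v) ∷ p) u with v ≟ u
  ... | yes _ = trans (cong (c * d +_) (coefficient-scale c p u)) (sym (ℚ.*-distribˡ-+ c d _))
  ... | no _  = coefficient-scale c p u

  coefficient-⊖ : ∀ p q u → coefficient (p ⊖ q) u ≡ coefficient p u + (- 1ℚ) * coefficient q u
  coefficient-⊖ p q u = trans (coefficient-++ p _ u) (cong (coefficient p u +_) (coefficient-scale (- 1ℚ) q u))

  ⊕-cong : ∀ {p p′ q q′} → p ≋ p′ → q ≋ q′ → p ⊕ q ≋ p′ ⊕ q′
  ⊕-cong {p} {p′} {q} {q′} h k = mk≋ λ u → begin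
    coefficient (p ++ q) u          ≡⟨ coefficient-++ p q u ⟩
    coefficient p u + coefficient q u   ≡⟨ cong₂ _+_ (at h u) (at k u) ⟩
    coefficient p′ u + coefficient q′ u ≡⟨ coefficient-++ p′ q′ u ⟨
    coefficient (p′ ++ q′) u        ∎
    where open ≡-Reasoning

  scale-cong : ∀ c {p q} → p ≋ q → scale c p ≋ scale c q
  scale-cong c {p} {q} h = mk≋ λ u →
    trans (coefficient-scale c p u) (trans (cong (c *_) (at h u)) (sym (coefficient-scale c q u)))

  ⊖-cong : ∀ {p p′ q q′} → p ≋ p′ → q ≋ q′ → p ⊖ q ≋ p′ ⊖ q′
  ⊖-cong h k = ⊕-cong h (scale-cong (- 1ℚ) k)

  ≋⇒⊖≋[] : ∀ {p q} → p ≋ q → p ⊖ q ≋ []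
  ≋⇒⊖≋[] {p} {q} h = mk≋ λ u → begin
    coefficient (p ⊖ q) u                         ≡⟨ coefficient-⊖ p q u ⟩
    coefficient p u + (- 1ℚ) * coefficient q u    ≡⟨ cong (λ c → coefficient p u + (- 1ℚ) * c) (at h u) ⟨
    coefficient p u + (- 1ℚ) * coefficient p u    ≡⟨ a-a≡0 (coefficient p u) ⟩
    0ℚ                                             ∎
    where open ≡-Reasoning

  ⊖≋[]⇒≋ : ∀ {p q} → p ⊖ q ≋ [] → p ≋ q
  ⊖≋[]⇒≋ {p} {q} h = mk≋ λ u → a-b≡0⇒a≡b (trans (sym (coefficient-⊖ p q u)) (at h u))

  coefficient-scale-⊕ : ∀ c p q u → coefficient (scale c p ⊕ q) u ≡ c * coefficient p u + coefficient q u
  coefficient-scale-⊕ c p q u =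
    trans (coefficient-++ (scale c p) q u) (cong (_+ coefficient q u) (coefficient-scale c p u))

  ⊖-[] : ∀ p → p ⊖ [] ≋ p
  ⊖-[] p = ≡⇒≋ (++-identityʳ p)

  word-⊕-scale : ∀ c u → word u ⊕ scale c (word u) ≋ scale (1ℚ + c) (word u)
  word-⊕-scale c u = mk≋ λ v → begin
    coefficient (word u ⊕ scale c (word u)) v                   ≡⟨ coefficient-++ (word u) _ v ⟩
    coefficient (word u) v + coefficient (scale c (word u)) v
      ≡⟨ cong (coefficient (word u) v +_) (coefficient-scale c (word u) v) ⟩
    coefficient (word u) v + c * coefficient (word u) v
      ≡⟨ solve 2 (λ k c → k :+ c :* k := (con 1ℚ :+ c) :* k) refl (coefficient (word u) v) c ⟩
    (1ℚ + c) * coefficient (word u) v                           ≡⟨ coefficient-scale (1ℚ + c) (word u) v ⟨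
    coefficient (scale (1ℚ + c) (word u)) v                     ∎
    where open ≡-Reasoning

  singleton≋scale-word : ∀ c u → (c , u) ∷ [] ≋ scale c (word u)
  singleton≋scale-word c u = ≡⇒≋ (cong (λ d → (d , u) ∷ []) (sym (ℚ.*-identityʳ c)))

  coefficient-here : ∀ c v p → coefficient ((c , v) ∷ p) v ≡ c + coefficient p v
  coefficient-here c v p with v ≟ v
  ... | yes _ = refl
  ... | no v≢v = ⊥-elim (v≢v refl)

  coefficient-there : ∀ c {v u} p → v ≢ u → coefficient ((c , v) ∷ p) u ≡ coefficient p u
  coefficient-there c {v} {u} p v≢u with v ≟ u
  ... | yes v≡u = ⊥-elim (v≢u v≡u)
  ... | no _ = refl

module _ {A : Set} where

  weightedSum : (A → ℚ) → Lin A → ℚ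
  weightedSum g [] = 0ℚ
  weightedSum g ((c , u) ∷ p) = c * g u + weightedSum g p

  weightedSum-++ : ∀ g p q → weightedSum g (p ++ q) ≡ weightedSum g p + weightedSum g q
  weightedSum-++ g [] q = sym (ℚ.+-identityˡ _)
  weightedSum-++ g ((c , u) ∷ p) q =
    trans (cong (c * g u +_) (weightedSum-++ g p q)) (sym (ℚ.+-assoc (c * g u) _ _))

  weightedSum-scale : ∀ g c p → weightedSum g (scale c p) ≡ c * weightedSum g p
  weightedSum-scale g c [] = sym (ℚ.*-zeroʳ c)
  weightedSum-scale g c ((d , u) ∷ p) = trans (cong (c * d * g u +_) (weightedSum-scale g c p))
    (solve 4 (λ c d a s → c :* d :* a :+ c :* s := c :* (d :* a :+ s)) refl c d (g u) (weightedSum g p))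

  weightedSum-congˡ : ∀ {g h} p → (∀ u → g u ≡ h u) → weightedSum g p ≡ weightedSum h p
  weightedSum-congˡ [] e = refl
  weightedSum-congˡ ((c , u) ∷ p) e = cong₂ (λ a s → c * a + s) (e u) (weightedSum-congˡ p e)

  weightedSum-+ : ∀ g h p → weightedSum (λ u → g u + h u) p ≡ weightedSum g p + weightedSum h p
  weightedSum-+ g h [] = sym (ℚ.+-identityˡ 0ℚ)
  weightedSum-+ g h ((c , u) ∷ p) = trans (cong (c * (g u + h u) +_) (weightedSum-+ g h p))
    (solve 5 (λ c a b s t → c :* (a :+ b) :+ (s :+ t) := (c :* a :+ s) :+ (c :* b :+ t))
      refl c (g u) (h u) (weightedSum g p) (weightedSum h p))

  weightedSum-* : ∀ g c p → weightedSum (λ u → c * g u) p ≡ c * weightedSum g p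
  weightedSum-* g c [] = sym (ℚ.*-zeroʳ c)
  weightedSum-* g c ((d , u) ∷ p) = trans (cong (d * (c * g u) +_) (weightedSum-* g c p))
    (solve 4 (λ c d a s → d :* (c :* a) :+ c :* s := c :* (d :* a :+ s)) refl c d (g u) (weightedSum g p))

module _ {A : Set} {{_ : DecEq A}} where

  remove : A → Lin A → Lin A
  remove u [] = []
  remove u ((c , v) ∷ p) with v ≟ u
  ... | yes _ = remove u p
  ... | no _  = (c , v) ∷ remove u p

  weightedSum-remove : ∀ (g : A → ℚ) u p →
                       weightedSum g p ≡ coefficient p u * g u + weightedSum g (remove u p)
  weightedSum-remove g u [] = sym (0*k+0≡0 (g u))
  weightedSum-remove g u ((c , v) ∷ p) with v ≟ u
  ... | yes refl = trans (cong (c * g v +_) (weightedSum-remove g v p))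
    (*-+-collect c (coefficient p v) (g v) (weightedSum g (remove v p)))
  ... | no _ = trans (cong (c * g v +_) (weightedSum-remove g u p))
    (+-exchange (c * g v) (coefficient p u * g u) (weightedSum g (remove u p)))

  coefficient-remove-≡ : ∀ u p → coefficient (remove u p) u ≡ 0ℚ
  coefficient-remove-≡ u [] = refl
  coefficient-remove-≡ u ((c , v) ∷ p) with v ≟ u
  ... | yes _ = coefficient-remove-≡ u p
  ... | no v≢u = trans (coefficient-there c (remove u p) v≢u) (coefficient-remove-≡ u p)

  coefficient-remove-≢ : ∀ {u w} p → u ≢ w → coefficient (remove u p) w ≡ coefficient p w
  coefficient-remove-≢ [] u≢w = refl
  coefficient-remove-≢ {u} {w} ((c , v) ∷ p) u≢w with v ≟ u
  ... | yes refl = sym (trans (coefficient-there c p u≢w) (sym (coefficient-remove-≢ p u≢w)))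
  ... | no _ with v ≟ w
  ...   | yes _ = cong (c +_) (coefficient-remove-≢ p u≢w)
  ...   | no _  = coefficient-remove-≢ p u≢w

  length-remove : ∀ u p → length (remove u p) ≤ length p
  length-remove u [] = z≤n
  length-remove u ((c , v) ∷ p) with v ≟ u
  ... | yes _ = ℕ.m≤n⇒m≤1+n (length-remove u p)
  ... | no _  = s≤s (length-remove u p)

  -- The bound n makes the recursion through remove u p structural.
  weightedSum-≋[]-bounded : ∀ (g : A → ℚ) n p → length p ≤ n → p ≋ [] → weightedSum g p ≡ 0ℚ
  weightedSum-≋[]-bounded g n [] _ _ = refl
  weightedSum-≋[]-bounded g (suc n) ((c , u) ∷ p) (s≤s |p|≤n) p≋[] = begin
    c * g u + weightedSum g p
      ≡⟨ cong (c * g u +_) (weightedSum-remove g u p) ⟩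
    c * g u + (coefficient p u * g u + weightedSum g (remove u p))
      ≡⟨ *-+-collect c (coefficient p u) (g u) (weightedSum g (remove u p)) ⟩
    (c + coefficient p u) * g u + weightedSum g (remove u p)
      ≡⟨ cong₂ (λ k s → k * g u + s) (trans (sym (coefficient-here c u p)) (at p≋[] u))
               (weightedSum-≋[]-bounded g n (remove u p) (ℕ.≤-trans (length-remove u p) |p|≤n) rest≋[]) ⟩
    0ℚ * g u + 0ℚ
      ≡⟨ 0*k+0≡0 (g u) ⟩
    0ℚ
      ∎
    where
    open ≡-Reasoning
    rest-at : ∀ w → Dec (u ≡ w) → coefficient (remove u p) w ≡ 0ℚ
    rest-at w (yes refl) = coefficient-remove-≡ u p
    rest-at w (no u≢w) =
      trans (coefficient-remove-≢ p u≢w) (trans (sym (coefficient-there c p u≢w)) (at p≋[] w))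
    rest≋[] : remove u p ≋ []
    rest≋[] = mk≋ λ w → rest-at w (u ≟ w)

  weightedSum-cong : ∀ (g : A → ℚ) {p q} → p ≋ q → weightedSum g p ≡ weightedSum g q
  weightedSum-cong g {p} {q} p≋q = a-b≡0⇒a≡b (begin
    weightedSum g p + (- 1ℚ) * weightedSum g q   ≡⟨ cong (weightedSum g p +_) (weightedSum-scale g (- 1ℚ) q) ⟨
    weightedSum g p + weightedSum g (scale (- 1ℚ) q) ≡⟨ weightedSum-++ g p _ ⟨
    weightedSum g (p ⊖ q)                        ≡⟨ weightedSum-≋[]-bounded g _ (p ⊖ q) ℕ.≤-refl (≋⇒⊖≋[] p≋q) ⟩
    0ℚ                                           ∎)
    where open ≡-Reasoning

module _ {A B : Set} {{_ : DecEq B}} where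

  coefficient-linExt : ∀ (f : A → Lin B) p v →
                       coefficient (linExt f p) v ≡ weightedSum (λ u → coefficient (f u) v) p
  coefficient-linExt f [] v = refl
  coefficient-linExt f ((c , u) ∷ p) v = trans (coefficient-++ (scale c (f u)) _ v)
    (cong₂ _+_ (coefficient-scale c (f u) v) (coefficient-linExt f p v))

  linExt-congˡ : ∀ {f g : A → Lin B} p → (∀ u → f u ≋ g u) → linExt f p ≋ linExt g p
  linExt-congˡ {f} {g} p f≋g = mk≋ λ v → trans (coefficient-linExt f p v)
    (trans (weightedSum-congˡ p (λ u → at (f≋g u) v)) (sym (coefficient-linExt g p v)))

  linExt-scale : ∀ (f : A → Lin B) c p → linExt f (scale c p) ≋ scale c (linExt f p)
  linExt-scale f c p = mk≋ λ v → begin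
    coefficient (linExt f (scale c p)) v            ≡⟨ coefficient-linExt f (scale c p) v ⟩
    weightedSum (λ u → coefficient (f u) v) (scale c p) ≡⟨ weightedSum-scale _ c p ⟩
    c * weightedSum (λ u → coefficient (f u) v) p   ≡⟨ cong (c *_) (coefficient-linExt f p v) ⟨
    c * coefficient (linExt f p) v                  ≡⟨ coefficient-scale c (linExt f p) v ⟨
    coefficient (scale c (linExt f p)) v            ∎
    where open ≡-Reasoning

  linExt-⊕ : ∀ (f g : A → Lin B) p → linExt (λ u → f u ⊕ g u) p ≋ linExt f p ⊕ linExt g p
  linExt-⊕ f g p = mk≋ λ v → begin
    coefficient (linExt (λ u → f u ⊕ g u) p) v
      ≡⟨ coefficient-linExt _ p v ⟩
    weightedSum (λ u → coefficient (f u ⊕ g u) v) p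
      ≡⟨ weightedSum-congˡ p (λ u → coefficient-++ (f u) (g u) v) ⟩
    weightedSum (λ u → coefficient (f u) v + coefficient (g u) v) p
      ≡⟨ weightedSum-+ _ _ p ⟩
    weightedSum (λ u → coefficient (f u) v) p + weightedSum (λ u → coefficient (g u) v) p
      ≡⟨ cong₂ _+_ (coefficient-linExt f p v) (coefficient-linExt g p v) ⟨
    coefficient (linExt f p) v + coefficient (linExt g p) v
      ≡⟨ coefficient-++ (linExt f p) _ v ⟨
    coefficient (linExt f p ⊕ linExt g p) v
      ∎
    where open ≡-Reasoning

  linExt-scaleᶠ : ∀ (f : A → Lin B) c p → linExt (λ u → scale c (f u)) p ≋ scale c (linExt f p)
  linExt-scaleᶠ f c p = mk≋ λ v → begin
    coefficient (linExt (λ u → scale c (f u)) p) v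
      ≡⟨ coefficient-linExt _ p v ⟩
    weightedSum (λ u → coefficient (scale c (f u)) v) p
      ≡⟨ weightedSum-congˡ p (λ u → coefficient-scale c (f u) v) ⟩
    weightedSum (λ u → c * coefficient (f u) v) p
      ≡⟨ weightedSum-* _ c p ⟩
    c * weightedSum (λ u → coefficient (f u) v) p
      ≡⟨ cong (c *_) (coefficient-linExt f p v) ⟨
    c * coefficient (linExt f p) v
      ≡⟨ coefficient-scale c (linExt f p) v ⟨
    coefficient (scale c (linExt f p)) v
      ∎
    where open ≡-Reasoning

  linExt-⊖ : ∀ (f g : A → Lin B) p → linExt f p ⊖ linExt g p ≋ linExt (λ u → f u ⊖ g u) p
  linExt-⊖ f g p = ≋-trans (⊕-cong ≋-refl (≋-sym (linExt-scaleᶠ g (- 1ℚ) p)))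
    (≋-sym (linExt-⊕ f (λ u → scale (- 1ℚ) (g u)) p))

  linExt-word : ∀ (f : A → Lin B) u → linExt f (word u) ≋ f u
  linExt-word f u = mk≋ λ v → begin
    coefficient (scale 1ℚ (f u) ++ []) v   ≡⟨ coefficient-++ (scale 1ℚ (f u)) [] v ⟩
    coefficient (scale 1ℚ (f u)) v + 0ℚ    ≡⟨ ℚ.+-identityʳ _ ⟩
    coefficient (scale 1ℚ (f u)) v         ≡⟨ coefficient-scale 1ℚ (f u) v ⟩
    1ℚ * coefficient (f u) v               ≡⟨ ℚ.*-identityˡ _ ⟩
    coefficient (f u) v                    ∎
    where open ≡-Reasoning

  relabel-≋-linExt : ∀ (g : A → B) p → relabel g p ≋ linExt (word ∘ g) p
  relabel-≋-linExt g [] = ≋-refl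
  relabel-≋-linExt g ((c , u) ∷ p) =
    ⊕-cong (singleton≋scale-word c (g u)) (relabel-≋-linExt g p)

  linExt-relabel-swap : ∀ {L : Set} (g : L → A → B) (t : Lin L) p →
                        linExt (λ u → relabel (λ z → g z u) t) p ≋ linExt (λ z → relabel (g z) p) t
  linExt-relabel-swap g [] p = ≡⇒≋ (linExt-const-[] p)
  linExt-relabel-swap g ((k , z) ∷ t) p = begin
    linExt (λ u → (k , g z u) ∷ relabel (λ z′ → g z′ u) t) p
      ≈⟨ linExt-congˡ p (λ u → ⊕-cong (singleton≋scale-word k (g z u)) ≋-refl) ⟩
    linExt (λ u → scale k (word (g z u)) ⊕ relabel (λ z′ → g z′ u) t) p
      ≈⟨ linExt-⊕ (λ u → scale k (word (g z u))) (λ u → relabel (λ z′ → g z′ u) t) p ⟩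
    linExt (λ u → scale k (word (g z u))) p ⊕ linExt (λ u → relabel (λ z′ → g z′ u) t) p
      ≈⟨ ⊕-cong (linExt-scaleᶠ (word ∘ g z) k p) (linExt-relabel-swap g t p) ⟩
    scale k (linExt (word ∘ g z) p) ⊕ linExt (λ z′ → relabel (g z′) p) t
      ≈⟨ ⊕-cong (scale-cong k (≋-sym (relabel-≋-linExt (g z) p))) ≋-refl ⟩
    scale k (relabel (g z) p) ⊕ linExt (λ z′ → relabel (g z′) p) t
      ∎
    where open ≋-Reasoning

module _ {A B : Set} {{_ : DecEq A}} {{_ : DecEq B}} where

  linExt-cong : ∀ (f : A → Lin B) {p q} → p ≋ q → linExt f p ≋ linExt f q
  linExt-cong f {p} {q} p≋q = mk≋ λ v → trans (coefficient-linExt f p v)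
    (trans (weightedSum-cong (λ u → coefficient (f u) v) p≋q) (sym (coefficient-linExt f q v)))

  relabel-cong : ∀ (g : A → B) {p q} → p ≋ q → relabel g p ≋ relabel g q
  relabel-cong g {p} {q} p≋q =
    ≋-trans (relabel-≋-linExt g p) (≋-trans (linExt-cong (word ∘ g) p≋q) (≋-sym (relabel-≋-linExt g q)))

module _ {A : Set} {{_ : DecEq A}} where

  linExt-identity : ∀ (p : Lin A) → linExt word p ≋ p
  linExt-identity p = ≋-trans (≋-sym (relabel-≋-linExt (λ u → u) p)) (≡⇒≋ (map-id p))

module _ {A B C : Set} {{_ : DecEq C}} where

  linExt-∘ : ∀ (f : B → Lin C) (g : A → Lin B) p → linExt f (linExt g p) ≋ linExt (linExt f ∘ g) p
  linExt-∘ f g [] = ≋-refl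
  linExt-∘ f g ((c , u) ∷ p) = ≋-trans (≡⇒≋ (linExt-++ f (scale c (g u)) (linExt g p)))
    (⊕-cong (linExt-scale f c (g u)) (linExt-∘ f g p))

module _ {A B : Set} {{_ : DecEq A}} {{_ : DecEq B}} where

  record IsLinear (f : Lin A → Lin B) : Set where
    field
      preserves-≋ : ∀ {p q} → p ≋ q → f p ≋ f q
      ≋-linExt    : ∀ p → f p ≋ linExt (f ∘ word) p
  open IsLinear public

  ≋-linExt⇒IsLinear : ∀ {f : Lin A → Lin B} g → (∀ p → f p ≋ linExt g p) → IsLinear f
  ≋-linExt⇒IsLinear {f} g f≋g = record
    { preserves-≋ = λ {p} {q} p≋q → ≋-trans (f≋g p) (≋-trans (linExt-cong g p≋q) (≋-sym (f≋g q)))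
    ; ≋-linExt    = λ p → ≋-trans (f≋g p)
                      (linExt-congˡ p λ u → ≋-sym (≋-trans (f≋g (word u)) (linExt-word g u)))
    }

  linExt-IsLinear : ∀ (g : A → Lin B) → IsLinear (linExt g)
  linExt-IsLinear g = ≋-linExt⇒IsLinear g λ _ → ≋-refl

  IsLinear-⊖ : ∀ {f g} → IsLinear f → IsLinear g → IsLinear (λ p → f p ⊖ g p)
  IsLinear-⊖ {f} {g} f-lin g-lin = ≋-linExt⇒IsLinear (λ u → f (word u) ⊖ g (word u))
    λ p → ≋-trans (⊖-cong (≋-linExt f-lin p) (≋-linExt g-lin p)) (linExt-⊖ (f ∘ word) (g ∘ word) p)

  IsLinear-≋ : ∀ {f g} → IsLinear f → IsLinear g →
               (∀ u → f (word u) ≋ g (word u)) → ∀ p → f p ≋ g p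
  IsLinear-≋ f-lin g-lin f≋g p =
    ≋-trans (≋-linExt f-lin p) (≋-trans (linExt-congˡ p f≋g) (≋-sym (≋-linExt g-lin p)))

module _ {A B C : Set} {{_ : DecEq A}} {{_ : DecEq B}} {{_ : DecEq C}} where

  IsLinear-∘ : ∀ {f : Lin B → Lin C} {g : Lin A → Lin B} → IsLinear f → IsLinear g → IsLinear (f ∘ g)
  IsLinear-∘ {f} {g} f-lin g-lin = ≋-linExt⇒IsLinear (f ∘ g ∘ word) λ p → begin
    f (g p)
      ≈⟨ preserves-≋ f-lin (≋-linExt g-lin p) ⟩
    f (linExt (g ∘ word) p)
      ≈⟨ ≋-linExt f-lin _ ⟩
    linExt (f ∘ word) (linExt (g ∘ word) p)
      ≈⟨ linExt-∘ (f ∘ word) (g ∘ word) p ⟩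
    linExt (linExt (f ∘ word) ∘ g ∘ word) p
      ≈⟨ linExt-congˡ p (λ u → ≋-sym (≋-linExt f-lin (g (word u)))) ⟩
    linExt (f ∘ g ∘ word) p
      ∎
    where open ≋-Reasoning

_≟ₗ_ : DecidableEquality Letter
x ≟ₗ x = yes refl
x ≟ₗ y = no λ ()
y ≟ₗ x = no λ ()
y ≟ₗ y = yes refl

instance
  Letter-≡-isDecEquivalence : DecEq Letter
  Letter-≡-isDecEquivalence = isDecEquivalence _≟ₗ_

prefixWord : XYWord → Lin XYWord → Lin XYWord
prefixWord [] p = p
prefixWord (b ∷ s) p = prefix b (prefixWord s p)

prefixWord-cong : ∀ s {p q} → p ≋ q → prefixWord s p ≋ prefixWord s q
prefixWord-cong [] p≋q = p≋q
prefixWord-cong (b ∷ s) p≋q = relabel-cong (b ∷_) (prefixWord-cong s p≋q)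

prefixWord-linExt : (s : XYWord) (f : A → Lin XYWord) (p : Lin A) →
                    prefixWord s (linExt f p) ≡ linExt (prefixWord s ∘ f) p
prefixWord-linExt [] f p = refl
prefixWord-linExt (b ∷ s) f p =
  trans (cong (prefix b) (prefixWord-linExt s f p)) (relabel-linExt (b ∷_) (prefixWord s ∘ f) p)

prefixWord-≋-linExt : ∀ s p → prefixWord s p ≋ linExt (λ w → prefixWord s (word w)) p
prefixWord-≋-linExt s p =
  ≋-trans (prefixWord-cong s (≋-sym (linExt-identity p))) (≡⇒≋ (prefixWord-linExt s word p))

shuffle-y : XYWord → Lin XYWord
shuffle-y w = shW w (y ∷ [])

shuffle-xy : XYWord → Lin XYWord
shuffle-xy w = shW w (x ∷ y ∷ [])

-- w ∗ z₂ written letter by letter; on w = x^k y u the x-steps telescope to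
-- z_{k+1} (u ∗ z₂) + z_{k+3} u + z₂ z_{k+1} u.
stuffle-z₂ : XYWord → Lin XYWord
stuffle-z₂ [] = word (x ∷ y ∷ [])
stuffle-z₂ (x ∷ w) = prefix x (stuffle-z₂ w) ⊕ (word (x ∷ y ∷ x ∷ w) ⊖ word (x ∷ x ∷ y ∷ w))
stuffle-z₂ (y ∷ w) = prefix y (stuffle-z₂ w) ⊕ (word (x ∷ y ∷ y ∷ w) ⊕ word (x ∷ x ∷ y ∷ w))

φxy : XYWord → Lin XYWord
φxy w = stuffle-z₂ w ⊖ shuffle-xy w

σ : Letter → ℚ
σ x = - 1ℚ
σ y = 1ℚ

φ-rest : Letter → XYWord → Lin XYWord
φ-rest a w = scale (σ a) (word (x ∷ x ∷ y ∷ w)) ⊖ prefix x (prefix a (shuffle-y w))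

δ-rest-table : Letter → Letter → Letter → Lin Letter
δ-rest-table x x x = []
δ-rest-table x x y = (half , x) ∷ []
δ-rest-table x y x = (- 1ℚ , x) ∷ []
δ-rest-table x y y = (- 1ℚ , y) ∷ (- quarter , x) ∷ []
δ-rest-table y x x = (half , x) ∷ []
δ-rest-table y x y = (1ℚ , y) ∷ []
δ-rest-table y y x = (quarter , x) ∷ []
δ-rest-table y y y = []

-- δ(a w) − a δ(w), which only depends on the first two letters of w.
δ-rest : Letter → XYWord → Lin XYWord
δ-rest a (b ∷ c ∷ u) = relabel (_∷ u) (δ-rest-table a b c)
δ-rest x (y ∷ []) = (- half , []) ∷ []
δ-rest y (x ∷ []) = (half , []) ∷ []
δ-rest y (y ∷ []) = (quarter , []) ∷ []
δ-rest _ _ = []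

data Op : Set where
  Ш Φ Δ : Op
  R : Letter → Op

onWord : Op → XYWord → Lin XYWord
onWord Ш = shuffle-y
onWord Φ = φxy
onWord Δ = δW
onWord (R a) = δ-rest a

apply : Op → Lin XYWord → Lin XYWord
apply o = linExt (onWord o)

-- Normalisation of operator expressions

-- A term (s , a) stands for s · ⟦ a ⟧, where var i is the i-th entry of an environment,
-- ε the empty word and app o s a the operator o applied to s · ⟦ a ⟧.
data Atom : Set where
  var : ℕ → Atom
  ε : Atom
  app : Op → XYWord → Atom → Atom

Term : Set
Term = XYWord × Atom

prefixTerm : Letter → Term → Term
prefixTerm b (s , a) = (b ∷ s , a)

infixl 6 _⊕ᵉ_ _⊖ᵉ_
infix 7 _·_
data Expr : Set where
  _·_ : XYWord → Atom → Expr
  0ᵉ : Expr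
  _⊕ᵉ_ _⊖ᵉ_ : Expr → Expr → Expr
  scaleᵉ : ℚ → Expr → Expr
  prefixᵉ : Letter → Expr → Expr
  applyᵉ : Op → Expr → Expr

Evaluator : Set
Evaluator = Op → Term → Lin Term

nf : Evaluator → Expr → Lin Term
nf ev (s · a) = word (s , a)
nf ev 0ᵉ = []
nf ev (e ⊕ᵉ f) = nf ev e ⊕ nf ev f
nf ev (e ⊖ᵉ f) = nf ev e ⊖ nf ev f
nf ev (scaleᵉ c e) = scale c (nf ev e)
nf ev (prefixᵉ b e) = relabel (prefixTerm b) (nf ev e)
nf ev (applyᵉ o e) = linExt (ev o) (nf ev e)

stuck : Evaluator
stuck o (s , a) = word ([] , app o s a)

sameOp? : (o o′ : Op) → Maybe (o ≡ o′)
sameOp? Ш Ш = just refl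
sameOp? Φ Φ = just refl
sameOp? Δ Δ = just refl
sameOp? (R a) (R b) with a ≟ b
... | yes refl = just refl
... | no _ = nothing
sameOp? _ _ = nothing

sameAtom? : (a a′ : Atom) → Maybe (a ≡ a′)
sameAtom? (var i) (var j) with i ≟ j
... | yes refl = just refl
... | no _ = nothing
sameAtom? ε ε = just refl
sameAtom? (app o s a) (app o′ s′ a′) with sameOp? o o′ | s ≟ s′ | sameAtom? a a′
... | just refl | yes refl | just refl = just refl
... | _ | _ | _ = nothing
sameAtom? _ _ = nothing

sameTerm? : (t t′ : Term) → Maybe (t ≡ t′)
sameTerm? (s , a) (s′ , a′) with s ≟ s′ | sameAtom? a a′
... | yes refl | just refl = just refl
... | _ | _ = nothing

-- same? only has to be sound: a missed identification can only make cancels fail.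
module Cancellation {A : Set} (same? : (a b : A) → Maybe (a ≡ b)) where

  gather : A → Lin A → ℚ × Lin A
  gather a [] = 0ℚ , []
  gather a ((c , b) ∷ n) with same? b a
  ... | just _  = c + proj₁ (gather a n) , proj₂ (gather a n)
  ... | nothing = proj₁ (gather a n) , (c , b) ∷ proj₂ (gather a n)

  cancelsWithin : ℕ → Lin A → Bool
  cancelsWithin _ [] = true
  cancelsWithin zero (_ ∷ _) = false
  cancelsWithin (suc k) ((c , a) ∷ n) with (c + proj₁ (gather a n)) ℚ.≟ 0ℚ
  ... | yes _ = cancelsWithin k (proj₂ (gather a n))
  ... | no _  = false

  cancels : Lin A → Bool
  cancels n = cancelsWithin (length n) n

  module _ {B : Set} {{_ : DecEq B}} (f : A → Lin B) where

    gather-sound : ∀ a n → linExt f n ≋ scale (proj₁ (gather a n)) (f a) ⊕ linExt f (proj₂ (gather a n))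

    coefficient-gather : ∀ c a n u → coefficient (scale c (f a) ⊕ linExt f n) u ≡
      (c + proj₁ (gather a n)) * coefficient (f a) u + coefficient (linExt f (proj₂ (gather a n))) u
    coefficient-gather c a n u = begin
      coefficient (scale c (f a) ⊕ linExt f n) u
        ≡⟨ coefficient-scale-⊕ c (f a) _ u ⟩
      c * coefficient (f a) u + coefficient (linExt f n) u
        ≡⟨ cong (c * coefficient (f a) u +_) (trans (at (gather-sound a n) u) (coefficient-scale-⊕ d (f a) _ u)) ⟩
      c * coefficient (f a) u + (d * coefficient (f a) u + coefficient (linExt f r) u)
        ≡⟨ *-+-collect c d (coefficient (f a) u) (coefficient (linExt f r) u) ⟩
      (c + d) * coefficient (f a) u + coefficient (linExt f r) u
        ∎
      where
      open ≡-Reasoning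
      d = proj₁ (gather a n)
      r = proj₂ (gather a n)

    gather-sound a [] = mk≋ λ u →
      sym (trans (coefficient-scale-⊕ 0ℚ (f a) [] u) (0*k+0≡0 (coefficient (f a) u)))
    gather-sound a ((c , b) ∷ n) with same? b a
    ... | just refl = mk≋ λ u →
      trans (coefficient-gather c a n u) (sym (coefficient-scale-⊕ (c + proj₁ (gather a n)) (f a) _ u))
    ... | nothing = mk≋ λ u → begin
      coefficient (scale c (f b) ⊕ linExt f n) u
        ≡⟨ trans (coefficient-scale-⊕ c (f b) _ u) (cong (c * coefficient (f b) u +_) (at (gather-sound a n) u)) ⟩
      c * coefficient (f b) u + coefficient (scale d (f a) ⊕ linExt f r) u
        ≡⟨ trans (cong (c * coefficient (f b) u +_) (coefficient-scale-⊕ d (f a) _ u))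
                 (+-exchange (c * coefficient (f b) u) (d * coefficient (f a) u) (coefficient (linExt f r) u)) ⟩
      d * coefficient (f a) u + (c * coefficient (f b) u + coefficient (linExt f r) u)
        ≡⟨ trans (coefficient-scale-⊕ d (f a) _ u)
                 (cong (d * coefficient (f a) u +_) (coefficient-scale-⊕ c (f b) _ u)) ⟨
      coefficient (scale d (f a) ⊕ (scale c (f b) ⊕ linExt f r)) u
        ∎
      where
      open ≡-Reasoning
      d = proj₁ (gather a n)
      r = proj₂ (gather a n)

    cancelsWithin-sound : ∀ k n → T (cancelsWithin k n) → linExt f n ≋ []
    cancelsWithin-sound _ [] _ = ≋-refl
    cancelsWithin-sound (suc k) ((c , a) ∷ n) h with (c + proj₁ (gather a n)) ℚ.≟ 0ℚ
    ... | yes c+d≡0 = mk≋ λ u → begin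
      coefficient (scale c (f a) ⊕ linExt f n) u
        ≡⟨ coefficient-gather c a n u ⟩
      (c + proj₁ (gather a n)) * coefficient (f a) u + coefficient (linExt f (proj₂ (gather a n))) u
        ≡⟨ cong₂ (λ e s → e * coefficient (f a) u + s) c+d≡0 (at (cancelsWithin-sound k (proj₂ (gather a n)) h) u) ⟩
      0ℚ * coefficient (f a) u + 0ℚ
        ≡⟨ 0*k+0≡0 (coefficient (f a) u) ⟩
      0ℚ
        ∎
      where open ≡-Reasoning

    cancels-sound : ∀ n → T (cancels n) → linExt f n ≋ []
    cancels-sound n = cancelsWithin-sound (length n) n

open Cancellation sameTerm? using (cancels; cancels-sound)

module Semantics (ρ : ℕ → Lin XYWord) where

  ⟦_⟧ᵃ : Atom → Lin XYWord
  ⟦ var i ⟧ᵃ = ρ i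
  ⟦ ε ⟧ᵃ = word []
  ⟦ app o s a ⟧ᵃ = apply o (prefixWord s ⟦ a ⟧ᵃ)

  ⟦_⟧ᵗ : Term → Lin XYWord
  ⟦ s , a ⟧ᵗ = prefixWord s ⟦ a ⟧ᵃ

  ⟦_⟧ⁿ : Lin Term → Lin XYWord
  ⟦_⟧ⁿ = linExt ⟦_⟧ᵗ

  ⟦_⟧ᵉ : Expr → Lin XYWord
  ⟦ s · a ⟧ᵉ = ⟦ s , a ⟧ᵗ
  ⟦ 0ᵉ ⟧ᵉ = []
  ⟦ e ⊕ᵉ f ⟧ᵉ = ⟦ e ⟧ᵉ ⊕ ⟦ f ⟧ᵉ
  ⟦ e ⊖ᵉ f ⟧ᵉ = ⟦ e ⟧ᵉ ⊖ ⟦ f ⟧ᵉ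
  ⟦ scaleᵉ c e ⟧ᵉ = scale c ⟦ e ⟧ᵉ
  ⟦ prefixᵉ b e ⟧ᵉ = prefix b ⟦ e ⟧ᵉ
  ⟦ applyᵉ o e ⟧ᵉ = apply o ⟦ e ⟧ᵉ

  Sound : Evaluator → Set
  Sound ev = ∀ o t → ⟦ ev o t ⟧ⁿ ≋ apply o ⟦ t ⟧ᵗ

  stuck-sound : Sound stuck
  stuck-sound o (s , a) = linExt-word ⟦_⟧ᵗ ([] , app o s a)

  ⟦⟧ⁿ-prefix : ∀ b n → ⟦ relabel (prefixTerm b) n ⟧ⁿ ≡ prefix b ⟦ n ⟧ⁿ
  ⟦⟧ⁿ-prefix b n =
    trans (linExt-relabel ⟦_⟧ᵗ (prefixTerm b) n) (sym (relabel-linExt (b ∷_) ⟦_⟧ᵗ n))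

  ⟦⟧ⁿ-apply : ∀ ev → Sound ev → ∀ o n → ⟦ linExt (ev o) n ⟧ⁿ ≋ apply o ⟦ n ⟧ⁿ
  ⟦⟧ⁿ-apply ev sound o n = begin
    ⟦ linExt (ev o) n ⟧ⁿ              ≈⟨ linExt-∘ ⟦_⟧ᵗ (ev o) n ⟩
    linExt (⟦_⟧ⁿ ∘ ev o) n            ≈⟨ linExt-congˡ n (sound o) ⟩
    linExt (apply o ∘ ⟦_⟧ᵗ) n         ≈⟨ linExt-∘ (onWord o) ⟦_⟧ᵗ n ⟨
    apply o ⟦ n ⟧ⁿ                    ∎
    where open ≋-Reasoning

  ⟦⟧ⁿ-⊕-cong : ∀ n m {p q} → ⟦ n ⟧ⁿ ≋ p → ⟦ m ⟧ⁿ ≋ q → ⟦ n ⊕ m ⟧ⁿ ≋ p ⊕ q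
  ⟦⟧ⁿ-⊕-cong n m n≋p m≋q = ≋-trans (≡⇒≋ (linExt-++ ⟦_⟧ᵗ n _)) (⊕-cong n≋p m≋q)

  ⟦⟧ⁿ-scale-cong : ∀ c n {p} → ⟦ n ⟧ⁿ ≋ p → ⟦ scale c n ⟧ⁿ ≋ scale c p
  ⟦⟧ⁿ-scale-cong c n n≋p = ≋-trans (linExt-scale ⟦_⟧ᵗ c n) (scale-cong c n≋p)

  ⟦⟧ⁿ-⊖-cong : ∀ n m {p q} → ⟦ n ⟧ⁿ ≋ p → ⟦ m ⟧ⁿ ≋ q → ⟦ n ⊖ m ⟧ⁿ ≋ p ⊖ q
  ⟦⟧ⁿ-⊖-cong n m n≋p m≋q =
    ⟦⟧ⁿ-⊕-cong n (scale (- 1ℚ) m) n≋p (⟦⟧ⁿ-scale-cong (- 1ℚ) m m≋q)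

  ⟦⟧ⁿ-prefix-cong : ∀ b n {p} → ⟦ n ⟧ⁿ ≋ p → ⟦ relabel (prefixTerm b) n ⟧ⁿ ≋ prefix b p
  ⟦⟧ⁿ-prefix-cong b n n≋p = ≋-trans (≡⇒≋ (⟦⟧ⁿ-prefix b n)) (relabel-cong (b ∷_) n≋p)

  ⟦⟧ⁿ-prefix-⊕ : ∀ b n m {p q} → ⟦ n ⟧ⁿ ≋ p → ⟦ m ⟧ⁿ ≋ q →
                 ⟦ relabel (prefixTerm b) n ⊕ m ⟧ⁿ ≋ prefix b p ⊕ q
  ⟦⟧ⁿ-prefix-⊕ b n m n≋p = ⟦⟧ⁿ-⊕-cong (relabel (prefixTerm b) n) m (⟦⟧ⁿ-prefix-cong b n n≋p)

  nf-sound : ∀ ev → Sound ev → ∀ e → ⟦ nf ev e ⟧ⁿ ≋ ⟦ e ⟧ᵉ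
  nf-sound ev sound (s · a) = linExt-word ⟦_⟧ᵗ (s , a)
  nf-sound ev sound 0ᵉ = ≋-refl
  nf-sound ev sound (e ⊕ᵉ f) = ⟦⟧ⁿ-⊕-cong (nf ev e) (nf ev f) (nf-sound ev sound e) (nf-sound ev sound f)
  nf-sound ev sound (e ⊖ᵉ f) = ⟦⟧ⁿ-⊖-cong (nf ev e) (nf ev f) (nf-sound ev sound e) (nf-sound ev sound f)
  nf-sound ev sound (scaleᵉ c e) = ⟦⟧ⁿ-scale-cong c (nf ev e) (nf-sound ev sound e)
  nf-sound ev sound (prefixᵉ b e) = ⟦⟧ⁿ-prefix-cong b (nf ev e) (nf-sound ev sound e)
  nf-sound ev sound (applyᵉ o e) =
    ≋-trans (⟦⟧ⁿ-apply ev sound o (nf ev e)) (linExt-cong (onWord o) (nf-sound ev sound e))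

  ≋-by-normalisation : ∀ ev → Sound ev → ∀ e e′ →
                       T (cancels (nf ev (e ⊖ᵉ e′))) → ⟦ e ⟧ᵉ ≋ ⟦ e′ ⟧ᵉ
  ≋-by-normalisation ev sound e e′ h =
    ⊖≋[]⇒≋ (≋-trans (≋-sym (nf-sound ev sound (e ⊖ᵉ e′)))
                    (cancels-sound ⟦_⟧ᵗ (nf ev (e ⊖ᵉ e′)) h))

environment : List (Lin XYWord) → ℕ → Lin XYWord
environment [] _ = []
environment (p ∷ _) zero = p
environment (_ ∷ ps) (suc i) = environment ps i

module _ (ps : List (Lin XYWord)) where
  open Semantics (environment ps)

  ≋-by-rearrangement : ∀ e e′ → T (cancels (nf stuck (e ⊖ᵉ e′))) → ⟦ e ⟧ᵉ ≋ ⟦ e′ ⟧ᵉ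
  ≋-by-rearrangement = ≋-by-normalisation stuck stuck-sound

-- Prefix rules

φxy-prefix : ∀ a w → φxy (a ∷ w) ≋ prefix a (φxy w) ⊕ φ-rest a w
φxy-prefix x w = ≋-by-rearrangement (stuffle-z₂ w ∷ shuffle-xy w ∷ shuffle-y w ∷ word w ∷ [])
  ((prefixᵉ x ([] · var 0) ⊕ᵉ ((x ∷ y ∷ x ∷ []) · var 3 ⊖ᵉ (x ∷ x ∷ y ∷ []) · var 3)) ⊖ᵉ
   (prefixᵉ x ([] · var 1) ⊕ᵉ prefixᵉ x (prefixᵉ x ([] · var 2) ⊕ᵉ (y ∷ x ∷ []) · var 3)))
  (prefixᵉ x ([] · var 0 ⊖ᵉ [] · var 1) ⊕ᵉ
   (scaleᵉ (- 1ℚ) ((x ∷ x ∷ y ∷ []) · var 3) ⊖ᵉ prefixᵉ x (prefixᵉ x ([] · var 2))))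
  _
φxy-prefix y w = ≋-by-rearrangement (stuffle-z₂ w ∷ shuffle-xy w ∷ shuffle-y w ∷ word w ∷ [])
  ((prefixᵉ y ([] · var 0) ⊕ᵉ ((x ∷ y ∷ y ∷ []) · var 3 ⊕ᵉ (x ∷ x ∷ y ∷ []) · var 3)) ⊖ᵉ
   (prefixᵉ y ([] · var 1) ⊕ᵉ prefixᵉ x (prefixᵉ y ([] · var 2) ⊕ᵉ (y ∷ y ∷ []) · var 3)))
  (prefixᵉ y ([] · var 0 ⊖ᵉ [] · var 1) ⊕ᵉ
   (scaleᵉ 1ℚ ((x ∷ x ∷ y ∷ []) · var 3) ⊖ᵉ prefixᵉ x (prefixᵉ y ([] · var 2))))
  _

headᵉ : Letter → Letter → Expr → Expr
headᵉ y x e = scaleᵉ half e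
headᵉ x y e = scaleᵉ (- half) e
headᵉ y y e = scaleᵉ quarter e
headᵉ x x e = 0ᵉ

localᵉ : Letter → Letter → Letter → Expr
localᵉ y y x = scaleᵉ half ((y ∷ []) · var 1)
localᵉ x y y = scaleᵉ (- half) ((y ∷ []) · var 1)
localᵉ _ _ _ = 0ᵉ

tableᵉ : Lin Letter → Expr
tableᵉ [] = 0ᵉ
tableᵉ ((k , z) ∷ t) = scaleᵉ k ((z ∷ []) · var 1) ⊕ᵉ tableᵉ t

-- In the environment (δmid (b c u), u), these are δW (a b c u) and a δW (b c u) + δ-rest a (b c u).
δW-prefixᵉ δW-prefixᵉ′ : Letter → Letter → Letter → Expr
δW-prefixᵉ a b c = headᵉ a b ((c ∷ []) · var 1) ⊕ᵉ (localᵉ a b c ⊕ᵉ prefixᵉ a ([] · var 0))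
δW-prefixᵉ′ a b c =
  prefixᵉ a (headᵉ b c ([] · var 1) ⊕ᵉ [] · var 0) ⊕ᵉ tableᵉ (δ-rest-table a b c)

δW-prefix : ∀ a w → δW (a ∷ w) ≋ prefix a (δW w) ⊕ δ-rest a w
δW-prefix x (x ∷ x ∷ u) =
  ≋-by-rearrangement (δmid (x ∷ x ∷ u) ∷ word u ∷ []) (δW-prefixᵉ x x x) (δW-prefixᵉ′ x x x) _
δW-prefix x (x ∷ y ∷ u) =
  ≋-by-rearrangement (δmid (x ∷ y ∷ u) ∷ word u ∷ []) (δW-prefixᵉ x x y) (δW-prefixᵉ′ x x y) _
δW-prefix x (y ∷ x ∷ u) =
  ≋-by-rearrangement (δmid (y ∷ x ∷ u) ∷ word u ∷ []) (δW-prefixᵉ x y x) (δW-prefixᵉ′ x y x) _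
δW-prefix x (y ∷ y ∷ u) =
  ≋-by-rearrangement (δmid (y ∷ y ∷ u) ∷ word u ∷ []) (δW-prefixᵉ x y y) (δW-prefixᵉ′ x y y) _
δW-prefix y (x ∷ x ∷ u) =
  ≋-by-rearrangement (δmid (x ∷ x ∷ u) ∷ word u ∷ []) (δW-prefixᵉ y x x) (δW-prefixᵉ′ y x x) _
δW-prefix y (x ∷ y ∷ u) =
  ≋-by-rearrangement (δmid (x ∷ y ∷ u) ∷ word u ∷ []) (δW-prefixᵉ y x y) (δW-prefixᵉ′ y x y) _
δW-prefix y (y ∷ x ∷ u) =
  ≋-by-rearrangement (δmid (y ∷ x ∷ u) ∷ word u ∷ []) (δW-prefixᵉ y y x) (δW-prefixᵉ′ y y x) _
δW-prefix y (y ∷ y ∷ u) =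
  ≋-by-rearrangement (δmid (y ∷ y ∷ u) ∷ word u ∷ []) (δW-prefixᵉ y y y) (δW-prefixᵉ′ y y y) _
δW-prefix x [] = ≋-refl
δW-prefix y [] = ≋-refl
δW-prefix x (x ∷ []) = ≋-refl
δW-prefix x (y ∷ []) = ≋-refl
δW-prefix y (x ∷ []) = ≋-refl
δW-prefix y (y ∷ []) = ≋-refl

apply-Ш-prefix : ∀ b p → apply Ш (prefix b p) ≋ prefix b (apply Ш p) ⊕ prefix y (prefix b p)
apply-Ш-prefix b p = begin
  apply Ш (prefix b p)
    ≡⟨ linExt-relabel shuffle-y (b ∷_) p ⟩
  linExt (λ w → prefix b (shuffle-y w) ⊕ prefixWord (y ∷ b ∷ []) (word w)) p
    ≈⟨ linExt-⊕ (prefix b ∘ shuffle-y) _ p ⟩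
  linExt (prefix b ∘ shuffle-y) p ⊕ linExt (λ w → prefixWord (y ∷ b ∷ []) (word w)) p
    ≈⟨ ⊕-cong (≡⇒≋ (sym (relabel-linExt (b ∷_) shuffle-y p)))
              (≋-sym (prefixWord-≋-linExt (y ∷ b ∷ []) p)) ⟩
  prefix b (apply Ш p) ⊕ prefix y (prefix b p)
    ∎
  where open ≋-Reasoning

linExt-φ-rest : ∀ b p →
  linExt (φ-rest b) p ≋ scale (σ b) (prefixWord (x ∷ x ∷ y ∷ []) p) ⊖ prefixWord (x ∷ b ∷ []) (apply Ш p)
linExt-φ-rest b p = begin
  linExt (φ-rest b) p
    ≈⟨ linExt-⊖ (λ w → scale (σ b) (xxy· (word w))) (prefixWord (x ∷ b ∷ []) ∘ shuffle-y) p ⟨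
  linExt (λ w → scale (σ b) (xxy· (word w))) p ⊖ linExt (prefixWord (x ∷ b ∷ []) ∘ shuffle-y) p
    ≈⟨ ⊖-cong (linExt-scaleᶠ (xxy· ∘ word) (σ b) p)
              (≡⇒≋ (sym (prefixWord-linExt (x ∷ b ∷ []) shuffle-y p))) ⟩
  scale (σ b) (linExt (xxy· ∘ word) p) ⊖ prefixWord (x ∷ b ∷ []) (apply Ш p)
    ≈⟨ ⊖-cong (scale-cong (σ b) (prefixWord-≋-linExt (x ∷ x ∷ y ∷ []) p)) ≋-refl ⟨
  scale (σ b) (xxy· p) ⊖ prefixWord (x ∷ b ∷ []) (apply Ш p)
    ∎
  where
  open ≋-Reasoning
  xxy· : Lin XYWord → Lin XYWord
  xxy· = prefixWord (x ∷ x ∷ y ∷ [])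

apply-Φ-prefix : ∀ b p → apply Φ (prefix b p) ≋
  prefix b (apply Φ p) ⊕ (scale (σ b) (prefixWord (x ∷ x ∷ y ∷ []) p) ⊖ prefixWord (x ∷ b ∷ []) (apply Ш p))
apply-Φ-prefix b p = begin
  apply Φ (prefix b p)
    ≡⟨ linExt-relabel φxy (b ∷_) p ⟩
  linExt (φxy ∘ (b ∷_)) p
    ≈⟨ linExt-congˡ p (φxy-prefix b) ⟩
  linExt (λ w → prefix b (φxy w) ⊕ φ-rest b w) p
    ≈⟨ linExt-⊕ (prefix b ∘ φxy) (φ-rest b) p ⟩
  linExt (prefix b ∘ φxy) p ⊕ linExt (φ-rest b) p
    ≈⟨ ⊕-cong (≡⇒≋ (sym (relabel-linExt (b ∷_) φxy p))) (linExt-φ-rest b p) ⟩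
  prefix b (apply Φ p) ⊕ (scale (σ b) (prefixWord (x ∷ x ∷ y ∷ []) p) ⊖ prefixWord (x ∷ b ∷ []) (apply Ш p))
    ∎
  where open ≋-Reasoning

apply-Δ-prefix : ∀ b p → apply Δ (prefix b p) ≋ prefix b (apply Δ p) ⊕ apply (R b) p
apply-Δ-prefix b p = begin
  apply Δ (prefix b p)                            ≡⟨ linExt-relabel δW (b ∷_) p ⟩
  linExt (δW ∘ (b ∷_)) p                          ≈⟨ linExt-congˡ p (δW-prefix b) ⟩
  linExt (λ w → prefix b (δW w) ⊕ δ-rest b w) p   ≈⟨ linExt-⊕ (prefix b ∘ δW) (δ-rest b) p ⟩
  linExt (prefix b ∘ δW) p ⊕ apply (R b) p        ≡⟨ cong (_⊕ apply (R b) p) (relabel-linExt (b ∷_) δW p) ⟨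
  prefix b (apply Δ p) ⊕ apply (R b) p            ∎
  where open ≋-Reasoning

apply-R-prefix² : ∀ a b c p →
                  apply (R a) (prefix b (prefix c p)) ≋ linExt (λ z → prefix z p) (δ-rest-table a b c)
apply-R-prefix² a b c p = begin
  apply (R a) (prefix b (prefix c p))
    ≡⟨ trans (linExt-relabel (δ-rest a) (b ∷_) (prefix c p))
             (linExt-relabel (δ-rest a ∘ (b ∷_)) (c ∷_) p) ⟩
  linExt (λ u → relabel (_∷ u) (δ-rest-table a b c)) p
    ≈⟨ linExt-relabel-swap _∷_ (δ-rest-table a b c) p ⟩
  linExt (λ z → prefix z p) (δ-rest-table a b c)
    ∎
  where open ≋-Reasoning

evalШ : XYWord → Atom → Lin Term
evalШ (b ∷ s) a = relabel (prefixTerm b) (evalШ s a) ⊕ word (y ∷ b ∷ s , a)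
evalШ [] ε = word (y ∷ [] , ε)
evalШ [] a = stuck Ш ([] , a)

evalΦ : XYWord → Atom → Lin Term
evalΦ (b ∷ s) a = relabel (prefixTerm b) (evalΦ s a) ⊕
  (scale (σ b) (word (x ∷ x ∷ y ∷ s , a)) ⊖ relabel (prefixTerm x) (relabel (prefixTerm b) (evalШ s a)))
evalΦ [] ε = []
evalΦ [] a = stuck Φ ([] , a)

evalR : Letter → XYWord → Atom → Lin Term
evalR b (c ∷ d ∷ s) a = relabel (λ z → (z ∷ s , a)) (δ-rest-table b c d)
evalR b (c ∷ []) ε = relabel (λ _ → ([] , ε)) (δ-rest b (c ∷ []))
evalR b [] ε = []
evalR b s a = stuck (R b) (s , a)

evalΔ : XYWord → Atom → Lin Term
evalΔ (b ∷ s) a = relabel (prefixTerm b) (evalΔ s a) ⊕ evalR b s a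
evalΔ [] ε = []
evalΔ [] a = stuck Δ ([] , a)

-- Unlike stuck, evaluate pushes the operators through prefixes by the prefix rules.
evaluate : Evaluator
evaluate Ш (s , a) = evalШ s a
evaluate Φ (s , a) = evalΦ s a
evaluate Δ (s , a) = evalΔ s a
evaluate (R b) (s , a) = evalR b s a

module _ (ρ : ℕ → Lin XYWord) where
  open Semantics ρ

  evalШ-sound : ∀ s a → ⟦ evalШ s a ⟧ⁿ ≋ apply Ш ⟦ s , a ⟧ᵗ
  evalШ-sound (b ∷ s) a = ≋-trans
    (⟦⟧ⁿ-prefix-⊕ b (evalШ s a) (word (y ∷ b ∷ s , a))
      (evalШ-sound s a) (linExt-word ⟦_⟧ᵗ (y ∷ b ∷ s , a)))
    (≋-sym (apply-Ш-prefix b ⟦ s , a ⟧ᵗ))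
  evalШ-sound [] ε = ≋-refl
  evalШ-sound [] (var i) = stuck-sound Ш ([] , var i)
  evalШ-sound [] (app o s a) = stuck-sound Ш ([] , app o s a)

  evalΦ-sound : ∀ s a → ⟦ evalΦ s a ⟧ⁿ ≋ apply Φ ⟦ s , a ⟧ᵗ
  evalΦ-sound (b ∷ s) a = ≋-trans
    (⟦⟧ⁿ-prefix-⊕ b (evalΦ s a) (scale (σ b) xxy· ⊖ relabel (prefixTerm x) b·Ш) (evalΦ-sound s a)
      (⟦⟧ⁿ-⊖-cong (scale (σ b) xxy·) (relabel (prefixTerm x) b·Ш)
        (⟦⟧ⁿ-scale-cong (σ b) xxy· (linExt-word ⟦_⟧ᵗ (x ∷ x ∷ y ∷ s , a)))
        (⟦⟧ⁿ-prefix-cong x b·Ш (⟦⟧ⁿ-prefix-cong b (evalШ s a) (evalШ-sound s a)))))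
    (≋-sym (apply-Φ-prefix b ⟦ s , a ⟧ᵗ))
    where
    xxy· = word (x ∷ x ∷ y ∷ s , a)
    b·Ш = relabel (prefixTerm b) (evalШ s a)
  evalΦ-sound [] ε = ≋-sym (≋-trans (linExt-word φxy []) (≋⇒⊖≋[] {p = word (x ∷ y ∷ [])} ≋-refl))
  evalΦ-sound [] (var i) = stuck-sound Φ ([] , var i)
  evalΦ-sound [] (app o s a) = stuck-sound Φ ([] , app o s a)

  evalR-sound : ∀ b s a → ⟦ evalR b s a ⟧ⁿ ≋ apply (R b) ⟦ s , a ⟧ᵗ
  evalR-sound b (c ∷ d ∷ s) a = ≋-trans
    (≡⇒≋ (linExt-relabel ⟦_⟧ᵗ (λ z → (z ∷ s , a)) (δ-rest-table b c d)))
    (≋-sym (apply-R-prefix² b c d ⟦ s , a ⟧ᵗ))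
  evalR-sound x (x ∷ []) ε = ≋-refl
  evalR-sound x (y ∷ []) ε = ≋-refl
  evalR-sound y (x ∷ []) ε = ≋-refl
  evalR-sound y (y ∷ []) ε = ≋-refl
  evalR-sound b [] ε = ≋-refl
  evalR-sound b [] (var i) = stuck-sound (R b) ([] , var i)
  evalR-sound b [] (app o s a) = stuck-sound (R b) ([] , app o s a)
  evalR-sound b (c ∷ []) (var i) = stuck-sound (R b) (c ∷ [] , var i)
  evalR-sound b (c ∷ []) (app o s a) = stuck-sound (R b) (c ∷ [] , app o s a)

  evalΔ-sound : ∀ s a → ⟦ evalΔ s a ⟧ⁿ ≋ apply Δ ⟦ s , a ⟧ᵗ
  evalΔ-sound (b ∷ s) a = ≋-trans
    (⟦⟧ⁿ-prefix-⊕ b (evalΔ s a) (evalR b s a) (evalΔ-sound s a) (evalR-sound b s a))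
    (≋-sym (apply-Δ-prefix b ⟦ s , a ⟧ᵗ))
  evalΔ-sound [] ε = ≋-refl
  evalΔ-sound [] (var i) = stuck-sound Δ ([] , var i)
  evalΔ-sound [] (app o s a) = stuck-sound Δ ([] , app o s a)

  evaluate-sound : Sound evaluate
  evaluate-sound Ш (s , a) = evalШ-sound s a
  evaluate-sound Φ (s , a) = evalΦ-sound s a
  evaluate-sound Δ (s , a) = evalΔ-sound s a
  evaluate-sound (R b) (s , a) = evalR-sound b s a

module _ (ps : List (Lin XYWord)) where
  open Semantics (environment ps)

  ≋-by-evaluation : ∀ e e′ → T (cancels (nf evaluate (e ⊖ᵉ e′))) → ⟦ e ⟧ᵉ ≋ ⟦ e′ ⟧ᵉ
  ≋-by-evaluation = ≋-by-normalisation evaluate (evaluate-sound (environment ps))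

-- The commutators on xy-words

allLetters : (Letter → Bool) → Bool
allLetters P = P x ∧ P y

allLetters-sound : ∀ (P : Letter → Bool) → T (allLetters P) → ∀ a → T (P a)
allLetters-sound P h x = proj₁ (Equivalence.to (T-∧ {P x} {P y}) h)
allLetters-sound P h y = proj₂ (Equivalence.to (T-∧ {P x} {P y}) h)

allLetters³ : (Letter → Letter → Letter → Bool) → Bool
allLetters³ P = allLetters (λ a → allLetters (λ b → allLetters (P a b)))

allLetters³-sound : ∀ P → T (allLetters³ P) → ∀ a b c → T (P a b c)
allLetters³-sound P h a b = allLetters-sound (P a b)
  (allLetters-sound (λ b → allLetters (P a b))
    (allLetters-sound (λ a → allLetters (λ b → allLetters (P a b))) h a) b)

ℕ→ℚ : ℕ → ℚ
ℕ→ℚ n = ℤ.+ n / 1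

ℕ→ℚ-suc : ∀ n → ℕ→ℚ (suc n) ≡ 1ℚ + ℕ→ℚ n
ℕ→ℚ-suc n = begin
  ℤ.+ suc n / 1                            ≡⟨ cong (_/ 1) (cong (λ k → ℤ.+ 1 ℤ.+ k) (ℤ.*-identityʳ (ℤ.+ n))) ⟨
  (ℤ.+ 1 ℤ.* ℤ.+ 1 ℤ.+ ℤ.+ n ℤ.* ℤ.+ 1) / 1  ≡⟨⟩
  1ℚ + n/1                                 ≡⟨ cong (1ℚ +_) (ℚ.↥p/↧p≡p n/1) ⟨
  1ℚ + ℤ.+ n / 1                           ∎
  where
  open ≡-Reasoning
  n/1 = mkℚ (ℤ.+ n) 0 (coprime-sym (1-coprimeTo n))

κ : Letter → ℚ
κ x = - 1ℚ
κ y = half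

commδШ commδШ-value commδШ-defect commδΦ : XYWord → Lin XYWord
commδШ w = apply Δ (apply Ш (word w)) ⊖ apply Ш (apply Δ (word w))
commδШ-value [] = []
commδШ-value (a ∷ w) = scale (κ a) (word w)
commδШ-defect w = commδШ w ⊖ commδШ-value w
commδΦ w = apply Δ (apply Φ (word w)) ⊖ apply Φ (apply Δ (word w))

commδШ-defectᵉ commδΦᵉ : XYWord → Atom → Expr
commδШ-defectᵉ s a = (applyᵉ Δ (applyᵉ Ш (s · a)) ⊖ᵉ applyᵉ Ш (applyᵉ Δ (s · a))) ⊖ᵉ value s
  where
  value : XYWord → Expr
  value [] = 0ᵉ
  value (b ∷ s′) = scaleᵉ (κ b) (s′ · a)
commδΦᵉ s a = applyᵉ Δ (applyᵉ Φ (s · a)) ⊖ᵉ applyᵉ Φ (applyᵉ Δ (s · a))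

commδШ-stepᵉ commδШ-stepᵉ′ : Letter → Letter → Letter → Expr
commδШ-stepᵉ a b c = commδШ-defectᵉ (a ∷ b ∷ c ∷ []) (var 0)
commδШ-stepᵉ′ a b c = prefixᵉ a (commδШ-defectᵉ (b ∷ c ∷ []) (var 0))

commδШ-step : ∀ a b c u → commδШ-defect (a ∷ b ∷ c ∷ u) ≋ prefix a (commδШ-defect (b ∷ c ∷ u))
commδШ-step a b c u = ≋-by-evaluation (word u ∷ []) (commδШ-stepᵉ a b c) (commδШ-stepᵉ′ a b c)
  (allLetters³-sound (λ a b c → cancels (nf evaluate (commδШ-stepᵉ a b c ⊖ᵉ commδШ-stepᵉ′ a b c))) _ a b c)

commδΦ-stepᵉ commδΦ-stepᵉ′ : Letter → Letter → Letter → Expr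
commδΦ-stepᵉ a b c = commδΦᵉ (a ∷ b ∷ c ∷ []) (var 0)
commδΦ-stepᵉ′ a b c = ((a ∷ b ∷ c ∷ []) · var 0 ⊕ᵉ prefixᵉ a (commδΦᵉ (b ∷ c ∷ []) (var 0)))
  ⊖ᵉ prefixᵉ x (prefixᵉ a (commδШ-defectᵉ (b ∷ c ∷ []) (var 0)))

commδΦ-step : ∀ a b c u → commδΦ (a ∷ b ∷ c ∷ u) ≋
  (word (a ∷ b ∷ c ∷ u) ⊕ prefix a (commδΦ (b ∷ c ∷ u))) ⊖ prefix x (prefix a (commδШ-defect (b ∷ c ∷ u)))
commδΦ-step a b c u = ≋-by-evaluation (word u ∷ []) (commδΦ-stepᵉ a b c) (commδΦ-stepᵉ′ a b c)
  (allLetters³-sound (λ a b c → cancels (nf evaluate (commδΦ-stepᵉ a b c ⊖ᵉ commδΦ-stepᵉ′ a b c))) _ a b c)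

EndsInY : XYWord → Set
EndsInY [] = ⊥
EndsInY (a ∷ []) = a ≡ y
EndsInY (_ ∷ b ∷ w) = EndsInY (b ∷ w)

InH¹ : XYWord → Set
InH¹ [] = ⊤
InH¹ (a ∷ w) = EndsInY (a ∷ w)

commδШ-H¹ : ∀ w → InH¹ w → commδШ-defect w ≋ []
commδШ-H¹ [] _ = ≋-by-evaluation [] (commδШ-defectᵉ [] ε) 0ᵉ _
commδШ-H¹ (y ∷ []) _ = ≋-by-evaluation [] (commδШ-defectᵉ (y ∷ []) ε) 0ᵉ _
commδШ-H¹ (x ∷ y ∷ []) _ = ≋-by-evaluation [] (commδШ-defectᵉ (x ∷ y ∷ []) ε) 0ᵉ _
commδШ-H¹ (y ∷ y ∷ []) _ = ≋-by-evaluation [] (commδШ-defectᵉ (y ∷ y ∷ []) ε) 0ᵉ _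
commδШ-H¹ (a ∷ b ∷ c ∷ u) h = ≋-trans (commδШ-step a b c u) (relabel-cong (a ∷_) (commδШ-H¹ (b ∷ c ∷ u) h))

commδΦ-H¹ : ∀ w → InH¹ w → commδΦ w ≋ scale (ℕ→ℚ (length w)) (word w)
commδΦ-H¹ [] _ = ≋-by-evaluation [] (commδΦᵉ [] ε) (scaleᵉ (ℕ→ℚ 0) ([] · ε)) _
commδΦ-H¹ (y ∷ []) _ = ≋-by-evaluation [] (commδΦᵉ (y ∷ []) ε) (scaleᵉ (ℕ→ℚ 1) ((y ∷ []) · ε)) _
commδΦ-H¹ (x ∷ y ∷ []) _ =
  ≋-by-evaluation [] (commδΦᵉ (x ∷ y ∷ []) ε) (scaleᵉ (ℕ→ℚ 2) ((x ∷ y ∷ []) · ε)) _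
commδΦ-H¹ (y ∷ y ∷ []) _ =
  ≋-by-evaluation [] (commδΦᵉ (y ∷ y ∷ []) ε) (scaleᵉ (ℕ→ℚ 2) ((y ∷ y ∷ []) · ε)) _
commδΦ-H¹ (a ∷ b ∷ c ∷ u) h = begin
  commδΦ w
    ≈⟨ commδΦ-step a b c u ⟩
  (word w ⊕ prefix a (commδΦ (b ∷ c ∷ u))) ⊖ prefix x (prefix a (commδШ-defect (b ∷ c ∷ u)))
    ≈⟨ ⊖-cong (⊕-cong {p = word w} ≋-refl (relabel-cong (a ∷_) (commδΦ-H¹ (b ∷ c ∷ u) h)))
              (relabel-cong (x ∷_) (relabel-cong (a ∷_) (commδШ-H¹ (b ∷ c ∷ u) h))) ⟩
  (word w ⊕ prefix a (scale n (word (b ∷ c ∷ u)))) ⊖ []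
    ≡⟨ cong (λ p → (word w ⊕ p) ⊖ []) (relabel-scale (a ∷_) n (word (b ∷ c ∷ u))) ⟩
  (word w ⊕ scale n (word w)) ⊖ []
    ≈⟨ ⊖-[] (word w ⊕ scale n (word w)) ⟩
  word w ⊕ scale n (word w)
    ≈⟨ word-⊕-scale n w ⟩
  scale (1ℚ + n) (word w)
    ≡⟨ cong (λ c → scale c (word w)) (ℕ→ℚ-suc (length (b ∷ c ∷ u))) ⟨
  scale (ℕ→ℚ (length w)) (word w)
    ∎
  where
  open ≋-Reasoning
  w = a ∷ b ∷ c ∷ u
  n = ℕ→ℚ (length (b ∷ c ∷ u))

-- From xy-words to 𝔥¹

AllWords : (A → Set) → Lin A → Set
AllWords P = All (P ∘ proj₂)

linExt-congˡ-AllWords : {{_ : DecEq B}} {P : A → Set} {f g : A → Lin B} →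
                        (∀ {u} → P u → f u ≋ g u) → ∀ {p} → AllWords P p → linExt f p ≋ linExt g p
linExt-congˡ-AllWords f≋g [] = ≋-refl
linExt-congˡ-AllWords f≋g {(c , _) ∷ _} (Pu ∷ Pp) =
  ⊕-cong (scale-cong c (f≋g Pu)) (linExt-congˡ-AllWords f≋g Pp)

EndsInY-∷ : ∀ a w → EndsInY w → EndsInY (a ∷ w)
EndsInY-∷ a (_ ∷ _) e = e

EndsInY⇒InH¹ : ∀ w → EndsInY w → InH¹ w
EndsInY⇒InH¹ (_ ∷ _) e = e

InH¹⇒EndsInY-y∷ : ∀ w → InH¹ w → EndsInY (y ∷ w)
InH¹⇒EndsInY-y∷ [] _ = refl
InH¹⇒EndsInY-y∷ (_ ∷ _) h = h

InH¹-tail : ∀ a w → InH¹ (a ∷ w) → InH¹ w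
InH¹-tail a [] _ = tt
InH¹-tail a (_ ∷ _) h = h

AllWords-prefix : ∀ b {p} → AllWords EndsInY p → AllWords EndsInY (prefix b p)
AllWords-prefix b h = map⁺ (All.map (λ {t} → EndsInY-∷ b (proj₂ t)) h)

shW-EndsInYʳ : ∀ u v → InH¹ u → EndsInY v → AllWords EndsInY (shW u v)
shW-EndsInYˡ : ∀ u v → EndsInY u → InH¹ v → AllWords EndsInY (shW u v)
shW-EndsInYʳ [] v _ ev = ev ∷ []
shW-EndsInYʳ (a ∷ u) (b ∷ v) hu ev = ++⁺ (AllWords-prefix a (shW-EndsInYʳ u (b ∷ v) (InH¹-tail a u hu) ev))
                                          (AllWords-prefix b (shW-EndsInYˡ (a ∷ u) v hu (InH¹-tail b v ev)))
shW-EndsInYˡ (a ∷ u) [] eu _ = eu ∷ []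
shW-EndsInYˡ (a ∷ u) (b ∷ v) eu hv = ++⁺ (AllWords-prefix a (shW-EndsInYʳ u (b ∷ v) (InH¹-tail a u eu) hv))
                                          (AllWords-prefix b (shW-EndsInYˡ (a ∷ u) v eu (InH¹-tail b v hv)))

stuffle-z₂-EndsInY : ∀ w → InH¹ w → AllWords EndsInY (stuffle-z₂ w)
stuffle-z₂-EndsInY [] _ = refl ∷ []
stuffle-z₂-EndsInY (x ∷ w) h = ++⁺ (AllWords-prefix x (stuffle-z₂-EndsInY w (InH¹-tail x w h)))
  (EndsInY-∷ x (y ∷ x ∷ w) (EndsInY-∷ y (x ∷ w) h)
   ∷ EndsInY-∷ x (x ∷ y ∷ w) (EndsInY-∷ x (y ∷ w) (InH¹⇒EndsInY-y∷ w (InH¹-tail x w h))) ∷ [])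
stuffle-z₂-EndsInY (y ∷ w) h = ++⁺ (AllWords-prefix y (stuffle-z₂-EndsInY w (InH¹-tail y w h)))
  (EndsInY-∷ x (y ∷ y ∷ w) (EndsInY-∷ y (y ∷ w) h)
   ∷ EndsInY-∷ x (x ∷ y ∷ w) (EndsInY-∷ x (y ∷ w) h) ∷ [])

φxy-InH¹ : ∀ w → InH¹ w → AllWords InH¹ (φxy w)
φxy-InH¹ w h = All.map (λ {t} → EndsInY⇒InH¹ (proj₂ t))
  (++⁺ (stuffle-z₂-EndsInY w h) (map⁺ (shW-EndsInYʳ w (x ∷ y ∷ []) h refl)))

δhead-InH¹ : ∀ w → InH¹ w → AllWords InH¹ (δhead w)
δhead-InH¹ (x ∷ y ∷ u) h = InH¹-tail y u h ∷ []
δhead-InH¹ (y ∷ x ∷ u) h = InH¹-tail x u h ∷ []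
δhead-InH¹ (y ∷ y ∷ u) h = InH¹-tail y u h ∷ []
δhead-InH¹ (x ∷ x ∷ u) _ = []
δhead-InH¹ (x ∷ []) _ = []
δhead-InH¹ (y ∷ []) _ = []
δhead-InH¹ [] _ = []

δmid-EndsInY : ∀ w → InH¹ w → AllWords EndsInY (δmid w)
δmid-EndsInY (x ∷ y ∷ y ∷ u) h =
  InH¹⇒EndsInY-y∷ u (InH¹-tail y u h) ∷ AllWords-prefix x (δmid-EndsInY (y ∷ y ∷ u) h)
δmid-EndsInY (y ∷ y ∷ x ∷ u) h =
  InH¹⇒EndsInY-y∷ u (InH¹-tail x u h) ∷ AllWords-prefix y (δmid-EndsInY (y ∷ x ∷ u) h)
δmid-EndsInY (x ∷ x ∷ x ∷ u) h = AllWords-prefix x (δmid-EndsInY (x ∷ x ∷ u) h)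
δmid-EndsInY (x ∷ x ∷ y ∷ u) h = AllWords-prefix x (δmid-EndsInY (x ∷ y ∷ u) h)
δmid-EndsInY (x ∷ y ∷ x ∷ u) h = AllWords-prefix x (δmid-EndsInY (y ∷ x ∷ u) h)
δmid-EndsInY (y ∷ x ∷ x ∷ u) h = AllWords-prefix y (δmid-EndsInY (x ∷ x ∷ u) h)
δmid-EndsInY (y ∷ x ∷ y ∷ u) h = AllWords-prefix y (δmid-EndsInY (x ∷ y ∷ u) h)
δmid-EndsInY (y ∷ y ∷ y ∷ u) h = AllWords-prefix y (δmid-EndsInY (y ∷ y ∷ u) h)
δmid-EndsInY (x ∷ x ∷ []) h = AllWords-prefix x (δmid-EndsInY (x ∷ []) h)
δmid-EndsInY (x ∷ y ∷ []) h = AllWords-prefix x (δmid-EndsInY (y ∷ []) h)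
δmid-EndsInY (y ∷ x ∷ []) h = AllWords-prefix y (δmid-EndsInY (x ∷ []) h)
δmid-EndsInY (y ∷ y ∷ []) h = AllWords-prefix y (δmid-EndsInY (y ∷ []) h)
δmid-EndsInY (x ∷ []) _ = []
δmid-EndsInY (y ∷ []) _ = []
δmid-EndsInY [] _ = []

δW-InH¹ : ∀ w → InH¹ w → AllWords InH¹ (δW w)
δW-InH¹ w h = ++⁺ (δhead-InH¹ w h) (All.map (λ {t} → EndsInY⇒InH¹ (proj₂ t)) (δmid-EndsInY w h))

replicate-x-++ : ∀ n (w : XYWord) → replicate (suc n) x ++ w ≡ replicate n x ++ x ∷ w
replicate-x-++ zero w = refl
replicate-x-++ (suc n) w = cong (x ∷_) (replicate-x-++ n w)

fromZ-toZ : ∀ w → InH¹ w → fromZ (toZ w) ≡ w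
fromZ-toZ′ : ∀ n w → EndsInY w → fromZ (toZ′ n w) ≡ replicate n x ++ w
fromZ-toZ [] _ = refl
fromZ-toZ (a ∷ w) h = fromZ-toZ′ 0 (a ∷ w) h
fromZ-toZ′ n (x ∷ b ∷ w) h = trans (fromZ-toZ′ (suc n) (b ∷ w) h) (replicate-x-++ n (b ∷ w))
fromZ-toZ′ n (y ∷ w) h = cong (λ v → replicate n x ++ y ∷ v) (fromZ-toZ w (InH¹-tail y w h))

toZ′-replicate : ∀ n m (w : XYWord) → toZ′ m (replicate n x ++ w) ≡ toZ′ (n ℕ.+ m) w
toZ′-replicate zero m w = refl
toZ′-replicate (suc n) m w = trans (toZ′-replicate n (suc m) w) (cong (λ k → toZ′ k w) (ℕ.+-suc n m))

toZ-fromZ : ∀ u → toZ (fromZ u) ≡ u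
toZ-fromZ [] = refl
toZ-fromZ (n ∷ u) = trans (toZ′-replicate n 0 (y ∷ fromZ u)) (cong₂ _∷_ (ℕ.+-identityʳ n) (toZ-fromZ u))

length-fromZ : ∀ u → length (fromZ u) ≡ weight u
length-fromZ [] = refl
length-fromZ (n ∷ u) = trans (length-++ (replicate n x))
  (trans (cong₂ ℕ._+_ (length-replicate n) (cong suc (length-fromZ u))) (ℕ.+-suc n (weight u)))

fromZ-InH¹ : ∀ u → InH¹ (fromZ u)
fromZ-InH¹ [] = tt
fromZ-InH¹ (n ∷ u) = EndsInY⇒InH¹ (fromZ (n ∷ u)) (replicate-EndsInY n)
  where
  replicate-EndsInY : ∀ k → EndsInY (replicate k x ++ y ∷ fromZ u)
  replicate-EndsInY zero = InH¹⇒EndsInY-y∷ (fromZ u) (fromZ-InH¹ u)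
  replicate-EndsInY (suc k) = EndsInY-∷ x (replicate k x ++ y ∷ fromZ u) (replicate-EndsInY k)

telescope : ∀ (P A B C : Lin ZWord) → (P ⊕ (A ⊕ B)) ⊕ (C ⊖ A) ≋ P ⊕ (C ⊕ B)
telescope P A B C = mk≋ λ u → begin
  coefficient ((P ⊕ (A ⊕ B)) ⊕ (C ⊖ A)) u
    ≡⟨ trans (coefficient-++ (P ⊕ (A ⊕ B)) _ u)
             (cong₂ _+_ (trans (coefficient-++ P _ u) (cong (coefficient P u +_) (coefficient-++ A B u)))
                        (coefficient-⊖ C A u)) ⟩
  (coefficient P u + (coefficient A u + coefficient B u)) + (coefficient C u + (- 1ℚ) * coefficient A u)
    ≡⟨ solve 4 (λ p a b c → (p :+ (a :+ b)) :+ (c :+ con (- 1ℚ) :* a) := p :+ (c :+ b)) refl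
         (coefficient P u) (coefficient A u) (coefficient B u) (coefficient C u) ⟩
  coefficient P u + (coefficient C u + coefficient B u)
    ≡⟨ trans (coefficient-++ P _ u) (cong (coefficient P u +_) (coefficient-++ C B u)) ⟨
  coefficient (P ⊕ (C ⊕ B)) u
    ∎
  where open ≡-Reasoning

-- After m letters x have been read, the x-steps of stuffle-z₂ telescope.
toZ′-stuffle-z₂ : ∀ n m w → relabel (toZ′ m) (stuffle-z₂ (replicate n x ++ y ∷ w)) ≋
  prefix (n ℕ.+ m) (toZLin (stuffle-z₂ w))
    ⊕ (word (suc m ∷ n ∷ toZ w) ⊕ word (suc (suc (n ℕ.+ m)) ∷ toZ w))
toZ′-stuffle-z₂ zero m w = ≡⇒≋ (begin
  relabel (toZ′ m) (prefix y (stuffle-z₂ w) ⊕ (word (x ∷ y ∷ y ∷ w) ⊕ word (x ∷ x ∷ y ∷ w)))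
    ≡⟨ relabel-++ (toZ′ m) (prefix y (stuffle-z₂ w)) _ ⟩
  relabel (toZ′ m) (prefix y (stuffle-z₂ w)) ⊕ (word (suc m ∷ 0 ∷ toZ w) ⊕ word (suc (suc m) ∷ toZ w))
    ≡⟨ cong (_⊕ (word (suc m ∷ 0 ∷ toZ w) ⊕ word (suc (suc m) ∷ toZ w)))
            (trans (relabel-∘ (toZ′ m) (y ∷_) (stuffle-z₂ w))
                   (sym (relabel-∘ (m ∷_) toZ (stuffle-z₂ w)))) ⟩
  prefix m (toZLin (stuffle-z₂ w)) ⊕ (word (suc m ∷ 0 ∷ toZ w) ⊕ word (suc (suc m) ∷ toZ w))
    ∎)
  where open ≡-Reasoning
toZ′-stuffle-z₂ (suc k) m w = begin
  relabel (toZ′ m) (prefix x (stuffle-z₂ v) ⊕ (word (x ∷ y ∷ x ∷ v) ⊖ word (x ∷ x ∷ y ∷ v)))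
    ≡⟨ relabel-++ (toZ′ m) (prefix x (stuffle-z₂ v)) _ ⟩
  relabel (toZ′ m) (prefix x (stuffle-z₂ v)) ⊕ (word (suc m ∷ toZ′ 1 v) ⊖ word (suc (suc m) ∷ toZ v))
    ≡⟨ cong (_⊕ (word (suc m ∷ toZ′ 1 v) ⊖ word (suc (suc m) ∷ toZ v)))
            (relabel-∘ (toZ′ m) (x ∷_) (stuffle-z₂ v)) ⟩
  relabel (toZ′ (suc m)) (stuffle-z₂ v) ⊕ (word (suc m ∷ toZ′ 1 v) ⊖ word (suc (suc m) ∷ toZ v))
    ≡⟨ cong₂ (λ s t → relabel (toZ′ (suc m)) (stuffle-z₂ v)
                       ⊕ (word (suc m ∷ s) ⊖ word (suc (suc m) ∷ t)))
             toZ′₁v toZv ⟩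
  relabel (toZ′ (suc m)) (stuffle-z₂ v) ⊕ (word (suc m ∷ suc k ∷ z) ⊖ word (suc (suc m) ∷ k ∷ z))
    ≈⟨ ⊕-cong (toZ′-stuffle-z₂ k (suc m) w) ≋-refl ⟩
  (P ⊕ (word (suc (suc m) ∷ k ∷ z) ⊕ Q)) ⊕ (word (suc m ∷ suc k ∷ z) ⊖ word (suc (suc m) ∷ k ∷ z))
    ≈⟨ telescope P (word (suc (suc m) ∷ k ∷ z)) Q (word (suc m ∷ suc k ∷ z)) ⟩
  P ⊕ (word (suc m ∷ suc k ∷ z) ⊕ Q)
    ≡⟨ cong (λ j → prefix j (toZLin (stuffle-z₂ w)) ⊕ (word (suc m ∷ suc k ∷ z) ⊕ word (suc (suc j) ∷ z)))
            (ℕ.+-suc k m) ⟩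
  prefix (suc k ℕ.+ m) (toZLin (stuffle-z₂ w))
    ⊕ (word (suc m ∷ suc k ∷ z) ⊕ word (suc (suc (suc k ℕ.+ m)) ∷ z))
    ∎
  where
  open ≋-Reasoning
  v = replicate k x ++ y ∷ w
  z = toZ w
  P = prefix (k ℕ.+ suc m) (toZLin (stuffle-z₂ w))
  Q = word (suc (suc (k ℕ.+ suc m)) ∷ z)
  toZ′₁v : toZ′ 1 v ≡ suc k ∷ z
  toZ′₁v = trans (toZ′-replicate k 1 (y ∷ w))
                 (cong (_∷ z) (trans (ℕ.+-suc k 0) (cong suc (ℕ.+-identityʳ k))))
  toZv : toZ v ≡ k ∷ z
  toZv = trans (toZ′-replicate k 0 (y ∷ w)) (cong (_∷ z) (ℕ.+-identityʳ k))

harmW-[] : ∀ u → harmW u [] ≡ word u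
harmW-[] [] = refl
harmW-[] (_ ∷ _) = refl

harmW-z₂ : ∀ u → harmW u (1 ∷ []) ≋ toZLin (stuffle-z₂ (fromZ u))
harmW-z₂ [] = ≋-refl
harmW-z₂ (n ∷ u) = begin
  (prefix n (harmW u (1 ∷ [])) ⊕ word (1 ∷ n ∷ u)) ⊕ prefix (suc (n ℕ.+ 1)) (harmW u [])
    ≡⟨ trans (cong (λ p → (prefix n (harmW u (1 ∷ [])) ⊕ word (1 ∷ n ∷ u)) ⊕ prefix (suc (n ℕ.+ 1)) p)
                   (harmW-[] u))
             (++-assoc (prefix n (harmW u (1 ∷ []))) _ _) ⟩
  prefix n (harmW u (1 ∷ [])) ⊕ (word (1 ∷ n ∷ u) ⊕ word (suc (n ℕ.+ 1) ∷ u))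
    ≈⟨ ⊕-cong (relabel-cong (n ∷_) (harmW-z₂ u)) ≋-refl ⟩
  prefix n P ⊕ (word (1 ∷ n ∷ u) ⊕ word (suc (n ℕ.+ 1) ∷ u))
    ≡⟨ cong (λ k → prefix n P ⊕ (word (1 ∷ n ∷ u) ⊕ word (suc k ∷ u)))
            (trans (ℕ.+-suc n 0) (cong suc (ℕ.+-identityʳ n))) ⟩
  prefix n P ⊕ (word (1 ∷ n ∷ u) ⊕ word (suc (suc n) ∷ u))
    ≡⟨ cong₂ (λ k v → prefix k P ⊕ (word (1 ∷ n ∷ v) ⊕ word (suc (suc k) ∷ v)))
             (sym (ℕ.+-identityʳ n)) (sym (toZ-fromZ u)) ⟩
  prefix (n ℕ.+ 0) P ⊕ (word (1 ∷ n ∷ toZ (fromZ u)) ⊕ word (suc (suc (n ℕ.+ 0)) ∷ toZ (fromZ u)))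
    ≈⟨ toZ′-stuffle-z₂ n 0 (fromZ u) ⟨
  toZLin (stuffle-z₂ (fromZ (n ∷ u)))
    ∎
  where
  open ≋-Reasoning
  P = toZLin (stuffle-z₂ (fromZ u))

∗-z₂ ш-z₂ : ZWord → H1
∗-z₂ u = linExt (harmW u) z₂
ш-z₂ u = linExt (λ v → toZLin (shW (fromZ u) (fromZ v))) z₂

φ-IsLinear : IsLinear φ
φ-IsLinear = ≋-linExt⇒IsLinear (λ u → ∗-z₂ u ⊖ ш-z₂ u) (linExt-⊖ ∗-z₂ ш-z₂)

δ-IsLinear : IsLinear δ
δ-IsLinear = linExt-IsLinear (λ u → toZLin (δW (fromZ u)))

φ-word : ∀ u → φ (word u) ≋ toZLin (φxy (fromZ u))
φ-word u = begin
  φ (word u)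
    ≈⟨ ⊖-cong (linExt-word ∗-z₂ u) (linExt-word ш-z₂ u) ⟩
  ∗-z₂ u ⊖ ш-z₂ u
    ≈⟨ ⊖-cong (linExt-word (harmW u) (1 ∷ [])) (linExt-word (λ v → toZLin (shW (fromZ u) (fromZ v))) (1 ∷ [])) ⟩
  harmW u (1 ∷ []) ⊖ toZLin (shuffle-xy (fromZ u))
    ≈⟨ ⊖-cong (harmW-z₂ u) ≋-refl ⟩
  toZLin (stuffle-z₂ (fromZ u)) ⊖ toZLin (shuffle-xy (fromZ u))
    ≡⟨ relabel-⊖ toZ (stuffle-z₂ (fromZ u)) (shuffle-xy (fromZ u)) ⟨
  toZLin (φxy (fromZ u))
    ∎
  where open ≋-Reasoning

δ-word : ∀ u → δ (word u) ≋ toZLin (δW (fromZ u))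
δ-word = linExt-word (λ u → toZLin (δW (fromZ u)))

IsLinear-toZLin : ∀ {f : H1 → H1} (F : XYWord → Lin XYWord) → IsLinear f →
                  (∀ u → f (word u) ≋ toZLin (F (fromZ u))) →
                  ∀ {q} → AllWords InH¹ q → f (toZLin q) ≋ toZLin (linExt F q)
IsLinear-toZLin {f} F f-lin f-word {q} q-InH¹ = begin
  f (toZLin q)                    ≈⟨ ≋-linExt f-lin (toZLin q) ⟩
  linExt (f ∘ word) (toZLin q)    ≡⟨ linExt-relabel (f ∘ word) toZ q ⟩
  linExt (f ∘ word ∘ toZ) q       ≈⟨ linExt-congˡ-AllWords on-H¹-word q-InH¹ ⟩
  linExt (toZLin ∘ F) q           ≡⟨ relabel-linExt toZ F q ⟨
  toZLin (linExt F q)             ∎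
  where
  open ≋-Reasoning
  on-H¹-word : ∀ {w} → InH¹ w → f (word (toZ w)) ≋ toZLin (F w)
  on-H¹-word {w} w-InH¹ = ≋-trans (f-word (toZ w)) (≡⇒≋ (cong (toZLin ∘ F) (fromZ-toZ w w-InH¹)))

commδφ-word≋commδΦ : ∀ u → commδφ (word u) ≋ toZLin (commδΦ (fromZ u))
commδφ-word≋commδΦ u = begin
  δ (φ (word u)) ⊖ φ (δ (word u))
    ≈⟨ ⊖-cong (preserves-≋ δ-IsLinear (φ-word u)) (preserves-≋ φ-IsLinear (δ-word u)) ⟩
  δ (toZLin (φxy w)) ⊖ φ (toZLin (δW w))
    ≈⟨ ⊖-cong (IsLinear-toZLin δW δ-IsLinear δ-word (φxy-InH¹ w w-InH¹))
              (IsLinear-toZLin φxy φ-IsLinear φ-word (δW-InH¹ w w-InH¹)) ⟩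
  toZLin (apply Δ (φxy w)) ⊖ toZLin (apply Φ (δW w))
    ≡⟨ relabel-⊖ toZ (apply Δ (φxy w)) (apply Φ (δW w)) ⟨
  toZLin (apply Δ (φxy w) ⊖ apply Φ (δW w))
    ≈⟨ relabel-cong toZ (⊖-cong (linExt-cong δW (linExt-word φxy w)) (linExt-cong φxy (linExt-word δW w))) ⟨
  toZLin (commδΦ w)
    ∎
  where
  open ≋-Reasoning
  w = fromZ u
  w-InH¹ = fromZ-InH¹ u

commδφ-word : ∀ u → commδφ (word u) ≋ W (word u)
commδφ-word u = begin
  commδφ (word u)                              ≈⟨ commδφ-word≋commδΦ u ⟩
  toZLin (commδΦ w)                            ≈⟨ relabel-cong toZ (commδΦ-H¹ w (fromZ-InH¹ u)) ⟩
  toZLin (scale (ℕ→ℚ (length w)) (word w))     ≡⟨ relabel-scale toZ (ℕ→ℚ (length w)) (word w) ⟩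
  scale (ℕ→ℚ (length w)) (word (toZ w))        ≡⟨ cong₂ (λ n v → scale (ℕ→ℚ n) (word v)) (length-fromZ u) (toZ-fromZ u) ⟩
  scale (ℕ→ℚ (weight u)) (word u)              ≈⟨ singleton≋scale-word (ℕ→ℚ (weight u)) u ⟨
  (ℕ→ℚ (weight u) , u) ∷ []                    ≈⟨ linExt-word (λ v → (ℕ→ℚ (weight v) , v) ∷ []) u ⟨
  W (word u)                                   ∎
  where
  open ≋-Reasoning
  w = fromZ u

coeff≡coefficient : ∀ p u → coeff p u ≡ coefficient p u
coeff≡coefficient [] u = refl
coeff≡coefficient ((c , v) ∷ p) u with v ≟ u
... | yes _ = cong (c +_) (coeff≡coefficient p u)
... | no _ = coeff≡coefficient p u

commδφ-IsLinear : IsLinear commδφ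
commδφ-IsLinear = IsLinear-⊖ (IsLinear-∘ δ-IsLinear φ-IsLinear) (IsLinear-∘ φ-IsLinear δ-IsLinear)

W-IsLinear : IsLinear W
W-IsLinear = linExt-IsLinear (λ u → (ℕ→ℚ (weight u) , u) ∷ [])

lemma3p5 : (w : H1) → commδφ w ≈ W w
lemma3p5 w u = begin
  coeff (commδφ w) u        ≡⟨ coeff≡coefficient (commδφ w) u ⟩
  coefficient (commδφ w) u  ≡⟨ at (IsLinear-≋ commδφ-IsLinear W-IsLinear commδφ-word w) u ⟩
  coefficient (W w) u       ≡⟨ coeff≡coefficient (W w) u ⟨
  coeff (W w) u             ∎
  where open ≡-Reasoning
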